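{- Let $q$ be an odd prime power, $\tau\in\mathbb F_q^*$, $\mu\in\mathbb F_q$, and let $N=N_{\tau,\mu}(S)$. For $j,k\in\mathbb F_q$ put $F=F_{\tau,\mu}(j,k)=\frac{\mu(k-j)}{2\tau}$ and $G=G_\tau(j,k)=\frac{k^2-j^2}{4\tau}$. Then $$N_{j,k}=\begin{cases}\eta(G)\,\zeta^{ -tr\left(\frac{F^2}{4G}\right)}S_{y^2}, & \text{if } G\neq 0,\\ 0,&\text{if } G=0 \text{ and } F\ne 0,\\ 0,&\text{if } j=k,\\ q,&\text{otherwise}.\end{cases}$$
   Context: Let $q=p^e$, $\zeta=e^{2\pi i/p}$, $tr(a)=a+a^p+\cdots+a^{p^{e-1}}$ the trace $\mathbb F_q\to\mathbb F_p$, $\eta$ the quadratic character of $\mathbb F_q$ ($\eta(0)=0$), and $S_{y^2}=\sum_{a\in\mathbb F_q}\zeta^{tr(a^2)}$. Let $G=(\mathbb F_q^5,\cdot)$ with $X\cdot Y=(x_1+y_1,x_2+y_2,x_3+y_3,x_4+y_4+2x_1y_2,x_5+y_5+2x_1y_3)$ and $S=\{(x,xa,xa^2,x^2a,x^2a^2):a,x\in\mathbb F_q,x\ne0\}$. For $\tau\in\mathbb F_q^*$, $\mu\in\mathbb F_q$ and $X\in G$, $N_{\tau,\mu}(X)$ is the $q\times q$ matrix with rows and columns indexed by $\mathbb F_q$ whose $(j,k)$ entry is $\zeta^{tr(x_3j+\tau x_5+\mu x_2)}$ if $k=2\tau x_1+j$ and $0$ otherwise; and $N_{\tau,\mu}(S)=\sum_{g\in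 S}N_{\tau,\mu}(g)$. -}

module Defs where

open import Level using (Level; _⊔_)
open import Data.Nat as ℕ using (ℕ; zero; suc)
open import Data.Bool using (Bool; true; false; if_then_else_)
open import Data.List using (List; []; _∷_; map; foldr; concatMap; filter; upTo)
open import Data.Bool.ListAction using (any)
open import Data.List.Membership.Propositional using (_∈_)
open import Data.List.Relation.Unary.Unique.Propositional using (Unique)
open import Data.Product using (Σ; _,_; proj₁)
open import Relation.Nullary using (¬_; yes; no; does; ¬?)
open import Relation.Nullary.Decidable using (⌊_⌋)
open import Relation.Binary.PropositionalEquality using (_≡_)
open import Relation.Binary.Definitions using (DecidableEquality)
open import Algebra.Structures using (IsCommutativeRing)
open import Algebra.Bundles using (CommutativeRing)

record FiniteField : Set₁ where
  infixl 6 _⊕_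
  infixl 7 _⊗_
  field
    F       : Set
    _⊕_ _⊗_ : F → F → F
    ⊖_      : F → F
    𝟘 𝟙     : F
    isCommutativeRing : IsCommutativeRing _≡_ _⊕_ _⊗_ ⊖_ 𝟘 𝟙
    _≟_     : DecidableEquality F
    𝟘≢𝟙     : ¬ (𝟘 ≡ 𝟙)
    inverse : (x : F) → ¬ (x ≡ 𝟘) → Σ F (λ y → x ⊗ y ≡ 𝟙)
    elems          : List F
    elems-unique   : Unique elems
    elems-complete : (x : F) → x ∈ elems

-- Field-side notions.  p is the characteristic, q = p ^ e.

module FieldNotions (FF : FiniteField) (p e : ℕ) where
  open FiniteField FF public

  natF : ℕ → F
  natF zero    = 𝟘
  natF (suc n) = 𝟙 ⊕ natF n

  two four : F
  two  = natF 2
  four = natF 4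

  powF : F → ℕ → F
  powF x zero    = 𝟙
  powF x (suc n) = x ⊗ powF x n

  -- x⁻¹ for x ≠ 0 (and 0 for x = 0; only used at nonzero arguments)
  inv : F → F
  inv x with x ≟ 𝟘
  ... | yes _  = 𝟘
  ... | no x≢0 = proj₁ (inverse x x≢0)

  infixl 7 _÷_
  _÷_ : F → F → F
  x ÷ y = x ⊗ inv y

  tr : F → F
  tr a = foldr _⊕_ 𝟘 (map (λ i → powF a (p ℕ.^ i)) (upTo e))

  -- the trace, which lies in the prime field F_p, read as a natural
  -- number in {0,...,p-1}: the least n < p with n·1 = tr a
  -- (defaults to 0 if there is none; never happens for char p)
  trℕ : F → ℕ
  trℕ a = go (upTo p)
    where
    go : List ℕ → ℕ
    go []       = 0
    go (n ∷ ns) with natF n ≟ tr a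
    ... | yes _ = n
    ... | no  _ = go ns

  isSquare : F → Bool
  isSquare x = any (λ y → ⌊ (y ⊗ y) ≟ x ⌋) elems

  nonzero : F → Bool
  nonzero x = if ⌊ x ≟ 𝟘 ⌋ then false else true

  Fτμ : F → F → F → F → F
  Fτμ τ μ j k = (μ ⊗ (k ⊕ ⊖ j)) ÷ (two ⊗ τ)

  Gτ : F → F → F → F
  Gτ τ j k = (k ⊗ k ⊕ ⊖ (j ⊗ j)) ÷ (four ⊗ τ)

  record G5 : Set where
    constructor ⟨_,_,_,_,_⟩
    field x₁ x₂ x₃ x₄ x₅ : F

  -- the set S = {(x, xa, xa², x²a, x²a²) : a, x ∈ F_q, x ≠ 0},
  -- listed once per pair (x,a); this parametrisation is injective.
  Sgen : F → F → G5
  Sgen x a = ⟨ x , x ⊗ a , x ⊗ a ⊗ a , x ⊗ x ⊗ a , x ⊗ x ⊗ a ⊗ a ⟩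

  Slist : List G5
  Slist = concatMap (λ x → map (Sgen x) elems) (filter (λ x → ¬? (x ≟ 𝟘)) elems)

-- The values (sums of p-th roots of unity,
-- η, q) live in Z[ζ] ⊂ ℂ.  We take them in an arbitrary commutative
-- ring R with an element ζ satisfying ζ^p = 1 and 1+ζ+...+ζ^(p-1) = 0;
-- since Z[x]/(Φ_p) ≅ Z[e^(2πi/p)] is the initial such ring, an identity
-- holding for all such (R, ζ) is equivalent to it holding in ℂ.

module ComplexNotions (FF : FiniteField) (p e : ℕ)
                      {c ℓ : Level} (R : CommutativeRing c ℓ)
                      (ζ : CommutativeRing.Carrier R) where
  open FieldNotions FF p e public
  open CommutativeRing R public
    using (Carrier; _≈_; _+_; _*_; -_; 0#; 1#)

  powR : Carrier → ℕ → Carrier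
  powR x zero    = 1#
  powR x (suc n) = x * powR x n

  sumR : List Carrier → Carrier
  sumR = foldr _+_ 0#

  natR : ℕ → Carrier
  natR zero    = 0#
  natR (suc n) = 1# + natR n

  ζtr : F → Carrier
  ζtr a = powR ζ (trℕ a)

  ζ-tr : F → Carrier
  ζ-tr a = powR ζ (p ℕ.∸ trℕ a)

  η : F → Carrier
  η x with x ≟ 𝟘
  ... | yes _ = 0#
  ... | no  _ = if isSquare x then 1# else - 1#

  Sy2 : Carrier
  Sy2 = sumR (map (λ a → ζtr (a ⊗ a)) elems)

  Nentry : F → F → G5 → F → F → Carrier
  Nentry τ μ X j k with k ≟ (two ⊗ τ ⊗ G5.x₁ X ⊕ j)
  ... | yes _ = ζtr (G5.x₃ X ⊗ j ⊕ τ ⊗ G5.x₅ X ⊕ μ ⊗ G5.x₂ X)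
  ... | no  _ = 0#

  NS : F → F → F → F → Carrier
  NS τ μ j k = sumR (map (λ g → Nentry τ μ g j k) Slist)

-- Row j of N(g), g = (x, xa, xa², x²a, x²a²) ∈ S, has its single entry in column 2τx + j, so N_{j,k}
-- collects only x = x₀ = (k - j)/2τ: it is 0 when j = k (then x₀ = 0 ∉ S) and otherwise equals
-- Σ_a ζ^tr(G a² + F a), because x₀ j + τ x₀² = G and μ x₀ = F. For G ≠ 0, completing the square turns
-- this into ζ^-tr(F²/4G) Σ_b ζ^tr(G b²), and Σ_b ζ^tr(G b²) = η(G) S_{y²}: for square G by scaling b, for
-- nonsquare G because the equations G b² = y and b² = y have two solutions together for every y, which
-- leaves 2 Σ_y ζ^tr(y) = 0. For G = 0 the sum Σ_a ζ^tr(F a) is 0 if F ≠ 0 and q otherwise.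
-- Σ_y ζ^tr(y) = 0 since tr takes each value of 𝔽_p equally often (translate by an element of trace 1)
-- and Σ_n ζⁿ = 0; the needed field facts (characteristic p, Frobenius, Fermat, tr landing in 𝔽_p and not
-- vanishing identically) all follow from |F| = pᵉ.

module Submission where

open import Defs
open import Level using (Level; 0ℓ)
open import Data.Bool using (Bool; true; false; if_then_else_)
open import Data.Bool.ListAction using (any)
open import Data.Nat as ℕ using (ℕ; zero; suc; _≤_; _<_; z≤n; s≤s; NonZero)
import Data.Nat.Properties as ℕP
open import Data.Nat.DivMod using (_%_; _/_; m≡m%n+[m/n]*n; m%n<n)
open import Data.Nat.Divisibility using (_∣_; ∣⇒≤; divides)
open import Data.Nat.Primality using (Prime; prime⇒irreducible; prime⇒nonZero; prime⇒nonTrivial; euclidsLemma)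
open import Data.Nat.Coprimality using (Coprime; coprime-Bézout)
open import Data.Nat.GCD using (module Bézout)
open import Data.Nat.Combinatorics using (_C_; nCn≡1; nC1≡n; nCk+nC[k+1]≡[n+1]C[k+1])
open import Data.Nat.Combinatorics.Specification using (k>n⇒nCk≡0)
open import Data.Nat.Solver using (module +-*-Solver)
open import Data.Integer as ℤ using (ℤ; +_; -[1+_])
import Data.Integer.Properties as ℤP
open import Data.Sign as Sign using (Sign)
open import Data.Fin as Fin using (Fin)
import Data.Fin.Properties as FinP
import Data.Vec.Functional as Vec
open import Data.List using (List; []; _∷_; map; foldr; _++_; length; replicate; upTo; filter; concatMap)
import Data.List.Properties as ListP
open import Data.List.Membership.Propositional using (_∈_; _∉_; find)
import Data.List.Membership.Propositional.Properties as ∈P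
open import Data.List.Relation.Unary.Any as Any using (here; there)
open import Data.List.Relation.Unary.All as All using (All; []; _∷_)
import Data.List.Relation.Unary.All.Properties as AllP
open import Data.List.Relation.Unary.AllPairs using (AllPairs; []; _∷_)
import Data.List.Relation.Unary.AllPairs.Properties as AllPairsP
open import Data.List.Relation.Unary.Unique.Propositional using (Unique)
import Data.List.Relation.Unary.Unique.Propositional.Properties as UniqueP
open import Data.Maybe using (Maybe; just; nothing)
open import Data.Product using (Σ; _,_; proj₁; proj₂; _×_; ∃)
open import Data.Sum using (_⊎_; inj₁; inj₂)
open import Data.Empty using (⊥-elim)
open import Function.Bundles using (_⇔_; mk⇔; Equivalence)
open import Relation.Unary using (Pred; Decidable)
open import Relation.Nullary using (¬_; Dec; yes; no; does; ¬?)
open import Relation.Nullary.Decidable using (⌊_⌋)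
open import Relation.Binary.PropositionalEquality as ≡ using (_≡_; refl; sym; trans; cong; cong₂; subst; subst₂)
open import Relation.Binary.Definitions using (DecidableEquality)
open import Algebra.Bundles using (CommutativeMonoid; CommutativeRing)
open import Algebra.Solver.Ring.AlmostCommutativeRing
  using (fromCommutativeRing; _-Raw-AlmostCommutative⟶_)
import Algebra.Properties.CommutativeSemiring.Binomial

module ListSum {c ℓ} (M : CommutativeMonoid c ℓ) where
  open CommutativeMonoid M renaming (refl to ≈-refl; sym to ≈-sym; trans to ≈-trans; reflexive to ≈-reflexive)
  open import Algebra.Properties.CommutativeSemigroup commutativeSemigroup using (interchange)
  open import Relation.Binary.Reasoning.Setoid setoid

  ∑ : {A : Set} → List A → (A → Carrier) → Carrier
  ∑ l f = foldr _∙_ ε (map f l)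

  when : Bool → Carrier → Carrier
  when b v = if b then v else ε

  module _ {A : Set} where

    ∑-cong : ∀ l {f g : A → Carrier} → (∀ x → f x ≈ g x) → ∑ l f ≈ ∑ l g
    ∑-cong []      f≈g = ≈-refl
    ∑-cong (x ∷ l) f≈g = ∙-cong (f≈g x) (∑-cong l f≈g)

    ∑-cong-∈ : ∀ l {f g : A → Carrier} → (∀ x → x ∈ l → f x ≈ g x) → ∑ l f ≈ ∑ l g
    ∑-cong-∈ []      f≈g = ≈-refl
    ∑-cong-∈ (x ∷ l) f≈g = ∙-cong (f≈g x (here refl)) (∑-cong-∈ l (λ y y∈l → f≈g y (there y∈l)))

    ∑-ε : ∀ (l : List A) → ∑ l (λ _ → ε) ≈ ε
    ∑-ε []      = ≈-refl
    ∑-ε (x ∷ l) = ≈-trans (identityˡ _) (∑-ε l)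

    ∑-∙ : ∀ l (f g : A → Carrier) → ∑ l (λ x → f x ∙ g x) ≈ ∑ l f ∙ ∑ l g
    ∑-∙ []      f g = ≈-sym (identityˡ ε)
    ∑-∙ (x ∷ l) f g = ≈-trans (∙-congˡ (∑-∙ l f g)) (interchange (f x) (g x) _ _)

    ∑-++ : ∀ xs ys (f : A → Carrier) → ∑ (xs ++ ys) f ≈ ∑ xs f ∙ ∑ ys f
    ∑-++ []       ys f = ≈-sym (identityˡ _)
    ∑-++ (x ∷ xs) ys f = ≈-trans (∙-congˡ (∑-++ xs ys f)) (≈-sym (assoc _ _ _))

    ∑-when : ∀ l b (f : A → Carrier) → ∑ l (λ x → when b (f x)) ≈ when b (∑ l f)
    ∑-when l true  f = ≈-refl
    ∑-when l false f = ∑-ε l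

    ∑-filter : ∀ {p} {P : Pred A p} (P? : Decidable P) l (f : A → Carrier) →
               ∑ (filter P? l) f ≈ ∑ l (λ x → when (does (P? x)) (f x))
    ∑-filter P? []      f = ≈-refl
    ∑-filter P? (x ∷ l) f with does (P? x)
    ... | true  = ∙-congˡ (∑-filter P? l f)
    ... | false = ≈-trans (∑-filter P? l f) (≈-sym (identityˡ _))

  ∑-map : ∀ {A B : Set} (g : A → B) (l : List A) (f : B → Carrier) → ∑ (map g l) f ≈ ∑ l (λ x → f (g x))
  ∑-map g l f = ≈-reflexive (cong (foldr _∙_ ε) (sym (ListP.map-∘ l)))

  ∑-concatMap : ∀ {A B : Set} (h : A → List B) (l : List A) (f : B → Carrier) →
                ∑ (concatMap h l) f ≈ ∑ l (λ x → ∑ (h x) f)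
  ∑-concatMap h []      f = ≈-refl
  ∑-concatMap h (x ∷ l) f = ≈-trans (∑-++ (h x) (concatMap h l) f) (∙-congˡ (∑-concatMap h l f))

  ∑-swap : ∀ {A B : Set} (l : List A) (m : List B) (h : A → B → Carrier) →
           ∑ l (λ x → ∑ m (h x)) ≈ ∑ m (λ y → ∑ l (λ x → h x y))
  ∑-swap l []      h = ∑-ε l
  ∑-swap l (y ∷ m) h = ≈-trans (∑-∙ l (λ x → h x y) (λ x → ∑ m (h x))) (∙-congˡ (∑-swap l m h))

  module _ {A : Set} (_≟_ : DecidableEquality A) where

    when-≟-cong : ∀ {x y x′ y′} v → (x ≡ y ⇔ x′ ≡ y′) → when (does (x ≟ y)) v ≈ when (does (x′ ≟ y′)) v
    when-≟-cong {x} {y} {x′} {y′} v x≡y⇔x′≡y′ with x ≟ y | x′ ≟ y′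
    ... | yes _   | yes _     = ≈-refl
    ... | no  _   | no  _     = ≈-refl
    ... | yes x≡y | no x′≢y′  = ⊥-elim (x′≢y′ (Equivalence.to x≡y⇔x′≡y′ x≡y))
    ... | no x≢y  | yes x′≡y′ = ⊥-elim (x≢y (Equivalence.from x≡y⇔x′≡y′ x′≡y′))

    ∑-select-∉ : ∀ l c (f : A → Carrier) → c ∉ l → ∑ l (λ y → when (does (y ≟ c)) (f y)) ≈ ε
    ∑-select-∉ []      c f c∉l = ≈-refl
    ∑-select-∉ (x ∷ l) c f c∉l with x ≟ c
    ... | yes refl = ⊥-elim (c∉l (here refl))
    ... | no  _    = ≈-trans (identityˡ _) (∑-select-∉ l c f (λ c∈l → c∉l (there c∈l)))

    ∑-select : ∀ l c (f : A → Carrier) → Unique l → c ∈ l → ∑ l (λ y → when (does (y ≟ c)) (f y)) ≈ f c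
    ∑-select (x ∷ l) c f (x∉l ∷ u) c∈ with x ≟ c
    ... | yes refl = ≈-trans (∙-congˡ (∑-select-∉ l x f (AllP.All¬⇒¬Any x∉l))) (identityʳ _)
    ... | no x≢c with c∈
    ...   | here c≡x   = ⊥-elim (x≢c (sym c≡x))
    ...   | there c∈l = ≈-trans (identityˡ _) (∑-select l c f u c∈l)

    ∑-reindex : ∀ (l : List A) → Unique l → (∀ x → x ∈ l) →
                (σ τ : A → A) → (∀ y → σ (τ y) ≡ y) → (∀ x → τ (σ x) ≡ x) →
                (f : A → Carrier) → ∑ l (λ x → f (σ x)) ≈ ∑ l f
    ∑-reindex l u complete σ τ στ τσ f = begin
      ∑ l (λ x → f (σ x))
        ≈⟨ ∑-cong l (λ x → ≈-sym (∑-select l (σ x) f u (complete (σ x)))) ⟩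
      ∑ l (λ x → ∑ l (λ y → when (does (y ≟ σ x)) (f y)))
        ≈⟨ ∑-swap l l (λ x y → when (does (y ≟ σ x)) (f y)) ⟩
      ∑ l (λ y → ∑ l (λ x → when (does (y ≟ σ x)) (f y)))
        ≈⟨ ∑-cong l (λ y → ∑-cong l (λ x → same-condition x y (f y))) ⟩
      ∑ l (λ y → ∑ l (λ x → when (does (x ≟ τ y)) (f y)))
        ≈⟨ ∑-cong l (λ y → ∑-select l (τ y) (λ _ → f y) u (complete (τ y))) ⟩
      ∑ l f ∎
      where
      same-condition : ∀ x y v → when (does (y ≟ σ x)) v ≈ when (does (x ≟ τ y)) v
      same-condition x y v = when-≟-cong v (mk⇔ (λ y≡σx → trans (sym (τσ x)) (cong τ (sym y≡σx)))
                                                (λ x≡τy → trans (sym (στ y)) (cong σ (sym x≡τy))))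

module ListSumℕ where
  open ListSum ℕP.+-0-commutativeMonoid

  ≤-∑-≡⇒≡ : ∀ {A : Set} (l : List A) (f g : A → ℕ) → (∀ x → f x ℕ.≤ g x) → ∑ l f ≡ ∑ l g → All (λ x → f x ≡ g x) l
  ≤-∑-≡⇒≡ []      f g f≤g eq = []
  ≤-∑-≡⇒≡ (x ∷ l) f g f≤g eq = fx≡gx ∷ ≤-∑-≡⇒≡ l f g f≤g (ℕP.+-cancelˡ-≡ (f x) _ _ (trans eq (cong (ℕ._+ ∑ l g) (sym fx≡gx))))
    where
    ∑-mono : ∀ l → ∑ l f ℕ.≤ ∑ l g
    ∑-mono []      = ℕ.z≤n
    ∑-mono (y ∷ l) = ℕP.+-mono-≤ (f≤g y) (∑-mono l)
    fx≡gx : f x ≡ g x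
    fx≡gx = ℕP.≤-antisym (f≤g x)
      (ℕP.+-cancelʳ-≤ (∑ l g) (g x) (f x) (subst (ℕ._≤ f x ℕ.+ ∑ l g) eq (ℕP.+-monoʳ-≤ (f x) (∑-mono l))))

-- The ring solver with integer coefficients, read in R along ℤ → R: unlike coefficients
-- taken from an abstract ring, these let normal forms be compared by computation.
module IntegerCoefficients {c ℓ : Level} (CR : CommutativeRing c ℓ) where
  open CommutativeRing CR renaming (refl to ≈-refl; sym to ≈-sym; trans to ≈-trans)
  open import Algebra.Properties.Ring ring using (-1*x≈-x)
  open import Algebra.Properties.AbelianGroup +-abelianGroup using (⁻¹-∙-comm; ⁻¹-involutive; ε⁻¹≈ε)
  open import Relation.Binary.Reasoning.Setoid setoid

  private
    fromℕ : ℕ → Carrier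
    fromℕ zero          = 0#
    fromℕ (suc zero)    = 1#
    fromℕ (suc (suc n)) = 1# + fromℕ (suc n)

    fromℕ-suc : ∀ n → fromℕ (suc n) ≈ 1# + fromℕ n
    fromℕ-suc zero    = ≈-sym (+-identityʳ _)
    fromℕ-suc (suc n) = ≈-refl

    fromℤ : ℤ → Carrier
    fromℤ (+ n)    = fromℕ n
    fromℤ -[1+ n ] = - fromℕ (suc n)

    fromℕ-+ : ∀ m n → fromℕ (m ℕ.+ n) ≈ fromℕ m + fromℕ n
    fromℕ-+ zero    n = ≈-sym (+-identityˡ _)
    fromℕ-+ (suc m) n = begin
      fromℕ (suc (m ℕ.+ n))      ≈⟨ fromℕ-suc (m ℕ.+ n) ⟩
      1# + fromℕ (m ℕ.+ n)       ≈⟨ +-congˡ (fromℕ-+ m n) ⟩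
      1# + (fromℕ m + fromℕ n)   ≈⟨ +-assoc _ _ _ ⟨
      (1# + fromℕ m) + fromℕ n   ≈⟨ +-congʳ (fromℕ-suc m) ⟨
      fromℕ (suc m) + fromℕ n    ∎

    fromℕ-* : ∀ m n → fromℕ (m ℕ.* n) ≈ fromℕ m * fromℕ n
    fromℕ-* zero    n = ≈-sym (zeroˡ _)
    fromℕ-* (suc m) n = begin
      fromℕ (n ℕ.+ m ℕ.* n)               ≈⟨ fromℕ-+ n (m ℕ.* n) ⟩
      fromℕ n + fromℕ (m ℕ.* n)           ≈⟨ +-congˡ (fromℕ-* m n) ⟩
      fromℕ n + fromℕ m * fromℕ n         ≈⟨ +-congʳ (*-identityˡ _) ⟨
      1# * fromℕ n + fromℕ m * fromℕ n    ≈⟨ distribʳ _ _ _ ⟨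
      (1# + fromℕ m) * fromℕ n            ≈⟨ *-congʳ (fromℕ-suc m) ⟨
      fromℕ (suc m) * fromℕ n             ∎

    fromℤ-neg : ∀ i → fromℤ (ℤ.- i) ≈ - fromℤ i
    fromℤ-neg (+ zero)  = ≈-sym ε⁻¹≈ε
    fromℤ-neg (+ suc n) = ≈-refl
    fromℤ-neg -[1+ n ]  = ≈-sym (⁻¹-involutive _)

    fromℤ-⊖ : ∀ m n → fromℤ (m ℤ.⊖ n) ≈ fromℕ m - fromℕ n
    fromℤ-⊖ m       zero    = ≈-sym (≈-trans (+-congˡ ε⁻¹≈ε) (+-identityʳ _))
    fromℤ-⊖ zero    (suc n) = ≈-sym (+-identityˡ _)
    fromℤ-⊖ (suc m) (suc n) = begin
      fromℤ (suc m ℤ.⊖ suc n)          ≡⟨ cong fromℤ (ℤP.[1+m]⊖[1+n]≡m⊖n m n) ⟩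
      fromℤ (m ℤ.⊖ n)                  ≈⟨ fromℤ-⊖ m n ⟩
      fromℕ m - fromℕ n                ≈⟨ cancel 1# (fromℕ m) (fromℕ n) ⟨
      (1# + fromℕ m) - (1# + fromℕ n)  ≈⟨ +-cong (fromℕ-suc m) (-‿cong (fromℕ-suc n)) ⟨
      fromℕ (suc m) - fromℕ (suc n)    ∎
      where
      cancel : ∀ a x y → (a + x) - (a + y) ≈ x - y
      cancel a x y = begin
        (a + x) - (a + y)     ≈⟨ +-congˡ (⁻¹-∙-comm a y) ⟨
        (a + x) + (- a - y)   ≈⟨ +-assoc _ _ _ ⟩
        a + (x + (- a - y))   ≈⟨ +-congˡ (+-congˡ (+-comm _ _)) ⟩
        a + (x + (- y - a))   ≈⟨ +-congˡ (+-assoc _ _ _) ⟨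
        a + ((x - y) - a)     ≈⟨ +-congˡ (+-comm _ _) ⟩
        a + (- a + (x - y))   ≈⟨ +-assoc _ _ _ ⟨
        (a - a) + (x - y)     ≈⟨ +-congʳ (-‿inverseʳ a) ⟩
        0# + (x - y)          ≈⟨ +-identityˡ _ ⟩
        x - y                 ∎

    fromℤ-+ : ∀ i j → fromℤ (i ℤ.+ j) ≈ fromℤ i + fromℤ j
    fromℤ-+ (+ m)    (+ n)    = fromℕ-+ m n
    fromℤ-+ (+ m)    -[1+ n ] = fromℤ-⊖ m (suc n)
    fromℤ-+ -[1+ m ] (+ n)    = ≈-trans (fromℤ-⊖ n (suc m)) (+-comm _ _)
    fromℤ-+ -[1+ m ] -[1+ n ] = begin
      - fromℕ (suc (suc (m ℕ.+ n)))     ≡⟨ cong (λ k → - fromℕ (suc k)) (sym (ℕP.+-suc m n)) ⟩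
      - fromℕ (suc m ℕ.+ suc n)         ≈⟨ -‿cong (fromℕ-+ (suc m) (suc n)) ⟩
      - (fromℕ (suc m) + fromℕ (suc n)) ≈⟨ ⁻¹-∙-comm _ _ ⟨
      - fromℕ (suc m) - fromℕ (suc n)   ∎

    fromSign : Sign → Carrier
    fromSign Sign.+ = 1#
    fromSign Sign.- = - 1#

    fromSign-* : ∀ s t → fromSign (s Sign.* t) ≈ fromSign s * fromSign t
    fromSign-* Sign.+ Sign.+ = ≈-sym (*-identityˡ _)
    fromSign-* Sign.+ Sign.- = ≈-sym (*-identityˡ _)
    fromSign-* Sign.- Sign.+ = ≈-sym (*-identityʳ _)
    fromSign-* Sign.- Sign.- = ≈-sym (≈-trans (-1*x≈-x (- 1#)) (⁻¹-involutive _))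

    fromℤ-◃ : ∀ s n → fromℤ (s ℤ.◃ n) ≈ fromSign s * fromℕ n
    fromℤ-◃ s      zero    = ≈-sym (zeroʳ _)
    fromℤ-◃ Sign.+ (suc n) = ≈-sym (*-identityˡ _)
    fromℤ-◃ Sign.- (suc n) = ≈-sym (-1*x≈-x _)

    fromℤ-sign-abs : ∀ i → fromℤ i ≈ fromSign (ℤ.sign i) * fromℕ ℤ.∣ i ∣
    fromℤ-sign-abs (+ n)    = ≈-sym (*-identityˡ _)
    fromℤ-sign-abs -[1+ n ] = ≈-sym (-1*x≈-x _)

    fromℤ-* : ∀ i j → fromℤ (i ℤ.* j) ≈ fromℤ i * fromℤ j
    fromℤ-* i j = begin
      fromℤ (i ℤ.* j)
        ≈⟨ fromℤ-◃ (ℤ.sign i Sign.* ℤ.sign j) (ℤ.∣ i ∣ ℕ.* ℤ.∣ j ∣) ⟩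
      fromSign (ℤ.sign i Sign.* ℤ.sign j) * fromℕ (ℤ.∣ i ∣ ℕ.* ℤ.∣ j ∣)
        ≈⟨ *-cong (fromSign-* (ℤ.sign i) (ℤ.sign j)) (fromℕ-* ℤ.∣ i ∣ ℤ.∣ j ∣) ⟩
      (fromSign (ℤ.sign i) * fromSign (ℤ.sign j)) * (fromℕ ℤ.∣ i ∣ * fromℕ ℤ.∣ j ∣)
        ≈⟨ interchange _ _ _ _ ⟩
      (fromSign (ℤ.sign i) * fromℕ ℤ.∣ i ∣) * (fromSign (ℤ.sign j) * fromℕ ℤ.∣ j ∣)
        ≈⟨ *-cong (fromℤ-sign-abs i) (fromℤ-sign-abs j) ⟨
      fromℤ i * fromℤ j ∎
      where open import Algebra.Properties.CommutativeSemigroup *-commutativeSemigroup using (interchange)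

    fromℤ-homomorphism : ℤ.+-*-rawRing -Raw-AlmostCommutative⟶ fromCommutativeRing CR
    fromℤ-homomorphism = record
      { ⟦_⟧ = fromℤ ; +-homo = fromℤ-+ ; *-homo = fromℤ-* ; -‿homo = fromℤ-neg
      ; 0-homo = ≈-refl ; 1-homo = ≈-refl }

    fromℤ-≟ : ∀ m n → Maybe (fromℤ m ≈ fromℤ n)
    fromℤ-≟ m n with m ℤ.≟ n
    ... | yes refl = just ≈-refl
    ... | no  _    = nothing

  open import Algebra.Solver.Ring ℤ.+-*-rawRing (fromCommutativeRing CR) fromℤ-homomorphism fromℤ-≟ public

module FiniteFieldTheory (FF : FiniteField) (p e : ℕ) where
  open FieldNotions FF p e public
  open ≡.≡-Reasoning

  ring : CommutativeRing 0ℓ 0ℓ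
  ring = record { isCommutativeRing = isCommutativeRing }

  open CommutativeRing ring public
    using ( +-comm; +-assoc; +-identityˡ; +-identityʳ; -‿inverseʳ
          ; *-comm; *-assoc; *-identityˡ; *-identityʳ; zeroˡ; zeroʳ; distribˡ; distribʳ )
  open IntegerCoefficients ring public using (solve; _:=_; _:+_; _:*_; _:-_; :-_; con; Polynomial)

  -- two and four as solver expressions, denoting natF 2 and natF 4 on the nose
  :two :four : ∀ {n} → Polynomial n
  :two  = con (+ 1) :+ (con (+ 1) :+ con (+ 0))
  :four = con (+ 1) :+ (con (+ 1) :+ :two)

  x⊕y⊖y≡x : ∀ x y → (x ⊕ y) ⊕ ⊖ y ≡ x
  x⊕y⊖y≡x = solve 2 (λ x y → (x :+ y) :- y := x) refl

  x⊖y⊕y≡x : ∀ x y → (x ⊕ ⊖ y) ⊕ y ≡ x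
  x⊖y⊕y≡x = solve 2 (λ x y → (x :- y) :+ y := x) refl

  ⊕-cancelʳ : ∀ {a b} c → a ⊕ c ≡ b ⊕ c → a ≡ b
  ⊕-cancelʳ {a} {b} c eq = begin
    a               ≡⟨ x⊕y⊖y≡x a c ⟨
    (a ⊕ c) ⊕ ⊖ c   ≡⟨ cong (_⊕ ⊖ c) eq ⟩
    (b ⊕ c) ⊕ ⊖ c   ≡⟨ x⊕y⊖y≡x b c ⟩
    b               ∎

  𝟙≢𝟘 : ¬ 𝟙 ≡ 𝟘
  𝟙≢𝟘 𝟙≡𝟘 = 𝟘≢𝟙 (sym 𝟙≡𝟘)

  inv-inverseʳ : ∀ {x} → ¬ x ≡ 𝟘 → x ⊗ inv x ≡ 𝟙
  inv-inverseʳ {x} x≢𝟘 with x ≟ 𝟘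
  ... | yes x≡𝟘 = ⊥-elim (x≢𝟘 x≡𝟘)
  ... | no  x≢𝟘 = proj₂ (inverse x x≢𝟘)

  inv-inverseˡ : ∀ {x} → ¬ x ≡ 𝟘 → inv x ⊗ x ≡ 𝟙
  inv-inverseˡ {x} x≢𝟘 = trans (*-comm (inv x) x) (inv-inverseʳ x≢𝟘)

  ⊗-inv-cancelʳ : ∀ a {b} → ¬ b ≡ 𝟘 → (a ⊗ inv b) ⊗ b ≡ a
  ⊗-inv-cancelʳ a {b} b≢𝟘 = trans (*-assoc a (inv b) b) (trans (cong (a ⊗_) (inv-inverseˡ b≢𝟘)) (*-identityʳ a))

  inv-⊗-cancelˡ : ∀ {a} → ¬ a ≡ 𝟘 → ∀ x → inv a ⊗ (a ⊗ x) ≡ x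
  inv-⊗-cancelˡ {a} a≢𝟘 x = trans (sym (*-assoc (inv a) a x)) (trans (cong (_⊗ x) (inv-inverseˡ a≢𝟘)) (*-identityˡ x))

  ⊗-inv-cancelˡ : ∀ {a} → ¬ a ≡ 𝟘 → ∀ x → a ⊗ (inv a ⊗ x) ≡ x
  ⊗-inv-cancelˡ {a} a≢𝟘 x = trans (sym (*-assoc a (inv a) x)) (trans (cong (_⊗ x) (inv-inverseʳ a≢𝟘)) (*-identityˡ x))

  ⊗≡⇒≡÷ : ∀ {a b c} → ¬ b ≡ 𝟘 → a ⊗ b ≡ c → a ≡ c ÷ b
  ⊗≡⇒≡÷ {a} {b} {c} b≢𝟘 ab≡c = begin
    a                  ≡⟨ *-identityʳ a ⟨
    a ⊗ 𝟙              ≡⟨ cong (a ⊗_) (inv-inverseʳ b≢𝟘) ⟨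
    a ⊗ (b ⊗ inv b)    ≡⟨ *-assoc a b (inv b) ⟨
    (a ⊗ b) ⊗ inv b    ≡⟨ cong (_⊗ inv b) ab≡c ⟩
    c ⊗ inv b          ∎

  ⊗-cancelʳ : ∀ {a b c} → ¬ c ≡ 𝟘 → a ⊗ c ≡ b ⊗ c → a ≡ b
  ⊗-cancelʳ c≢𝟘 eq = trans (⊗≡⇒≡÷ c≢𝟘 eq) (sym (⊗≡⇒≡÷ c≢𝟘 refl))

  zero-product : ∀ x y → x ⊗ y ≡ 𝟘 → x ≡ 𝟘 ⊎ y ≡ 𝟘
  zero-product x y xy≡𝟘 with x ≟ 𝟘
  ... | yes x≡𝟘 = inj₁ x≡𝟘
  ... | no  x≢𝟘 = inj₂ (begin
    y                  ≡⟨ inv-⊗-cancelˡ x≢𝟘 y ⟨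
    inv x ⊗ (x ⊗ y)    ≡⟨ cong (inv x ⊗_) xy≡𝟘 ⟩
    inv x ⊗ 𝟘          ≡⟨ zeroʳ (inv x) ⟩
    𝟘                  ∎)

  ⊗-≢𝟘 : ∀ {x y} → ¬ x ≡ 𝟘 → ¬ y ≡ 𝟘 → ¬ x ⊗ y ≡ 𝟘
  ⊗-≢𝟘 {x} {y} x≢𝟘 y≢𝟘 xy≡𝟘 with zero-product x y xy≡𝟘
  ... | inj₁ x≡𝟘 = x≢𝟘 x≡𝟘
  ... | inj₂ y≡𝟘 = y≢𝟘 y≡𝟘

  natF-+ : ∀ m n → natF (m ℕ.+ n) ≡ natF m ⊕ natF n
  natF-+ zero    n = sym (+-identityˡ (natF n))
  natF-+ (suc m) n = trans (cong (𝟙 ⊕_) (natF-+ m n)) (sym (+-assoc 𝟙 (natF m) (natF n)))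

  natF-* : ∀ m n → natF (m ℕ.* n) ≡ natF m ⊗ natF n
  natF-* zero    n = sym (zeroˡ (natF n))
  natF-* (suc m) n = begin
    natF (n ℕ.+ m ℕ.* n)             ≡⟨ natF-+ n (m ℕ.* n) ⟩
    natF n ⊕ natF (m ℕ.* n)          ≡⟨ cong (natF n ⊕_) (natF-* m n) ⟩
    natF n ⊕ natF m ⊗ natF n         ≡⟨ cong (_⊕ natF m ⊗ natF n) (*-identityˡ (natF n)) ⟨
    𝟙 ⊗ natF n ⊕ natF m ⊗ natF n     ≡⟨ distribʳ (natF n) 𝟙 (natF m) ⟨
    (𝟙 ⊕ natF m) ⊗ natF n            ∎

  powF-+ : ∀ x m n → powF x (m ℕ.+ n) ≡ powF x m ⊗ powF x n
  powF-+ x zero    n = sym (*-identityˡ _)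
  powF-+ x (suc m) n = trans (cong (x ⊗_) (powF-+ x m n)) (sym (*-assoc x _ _))

  powF-distrib-⊗ : ∀ x y n → powF (x ⊗ y) n ≡ powF x n ⊗ powF y n
  powF-distrib-⊗ x y zero    = sym (*-identityˡ 𝟙)
  powF-distrib-⊗ x y (suc n) = trans (cong ((x ⊗ y) ⊗_) (powF-distrib-⊗ x y n))
    (solve 4 (λ x y X Y → (x :* y) :* (X :* Y) := (x :* X) :* (y :* Y)) refl x y _ _)

  powF-𝟙 : ∀ n → powF 𝟙 n ≡ 𝟙
  powF-𝟙 zero    = refl
  powF-𝟙 (suc n) = trans (cong (𝟙 ⊗_) (powF-𝟙 n)) (*-identityˡ 𝟙)

  powF-* : ∀ x m n → powF x (m ℕ.* n) ≡ powF (powF x m) n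
  powF-* x zero    n = sym (powF-𝟙 n)
  powF-* x (suc m) n = begin
    powF x (n ℕ.+ m ℕ.* n)                 ≡⟨ powF-+ x n (m ℕ.* n) ⟩
    powF x n ⊗ powF x (m ℕ.* n)            ≡⟨ cong (powF x n ⊗_) (powF-* x m n) ⟩
    powF x n ⊗ powF (powF x m) n           ≡⟨ powF-distrib-⊗ x (powF x m) n ⟨
    powF (x ⊗ powF x m) n                  ∎

  powF-comm : ∀ x m n → powF (powF x m) n ≡ powF (powF x n) m
  powF-comm x m n = trans (sym (powF-* x m n)) (trans (cong (powF x) (ℕP.*-comm m n)) (powF-* x n m))

  powF-natF : ∀ m n → powF (natF m) n ≡ natF (m ℕ.^ n)
  powF-natF m zero    = sym (+-identityʳ 𝟙)
  powF-natF m (suc n) = trans (cong (natF m ⊗_) (powF-natF m n)) (sym (natF-* m (m ℕ.^ n)))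

  powF-𝟘 : ∀ n → powF 𝟘 (suc n) ≡ 𝟘
  powF-𝟘 n = zeroˡ _

  powF-≢𝟘 : ∀ {x} n → ¬ x ≡ 𝟘 → ¬ powF x n ≡ 𝟘
  powF-≢𝟘 zero    x≢𝟘 = 𝟙≢𝟘
  powF-≢𝟘 (suc n) x≢𝟘 = ⊗-≢𝟘 x≢𝟘 (powF-≢𝟘 n x≢𝟘)

  powF≡𝟘⇒≡𝟘 : ∀ {x} n → powF x n ≡ 𝟘 → x ≡ 𝟘
  powF≡𝟘⇒≡𝟘 {x} n xⁿ≡𝟘 with x ≟ 𝟘
  ... | yes x≡𝟘 = x≡𝟘
  ... | no  x≢𝟘 = ⊥-elim (powF-≢𝟘 n x≢𝟘 xⁿ≡𝟘)

  open import Algebra.Properties.Semiring.Exp (CommutativeRing.semiring ring) public using (_^_)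
  open import Algebra.Properties.Semiring.Mult (CommutativeRing.semiring ring) public using () renaming (_×_ to _·_)
  module Binomial = Algebra.Properties.CommutativeSemiring.Binomial (CommutativeRing.commutativeSemiring ring)

  ^≡powF : ∀ x n → x ^ n ≡ powF x n
  ^≡powF x zero    = refl
  ^≡powF x (suc n) = cong (x ⊗_) (^≡powF x n)

  ·≡natF⊗ : ∀ n x → n · x ≡ natF n ⊗ x
  ·≡natF⊗ zero    x = sym (zeroˡ x)
  ·≡natF⊗ (suc n) x = trans (cong (x ⊕_) (·≡natF⊗ n x))
    (solve 2 (λ x N → x :+ N :* x := (con (+ 1) :+ N) :* x) refl x (natF n))

  foldr-only-last : ∀ k (g : Fin (suc k) → F) → (∀ i → g (Fin.inject₁ i) ≡ 𝟘) → Vec.foldr _⊕_ 𝟘 g ≡ g (Fin.fromℕ k)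
  foldr-only-last zero    g g≡𝟘 = +-identityʳ _
  foldr-only-last (suc k) g g≡𝟘 = trans (cong (_⊕ Vec.foldr _⊕_ 𝟘 (λ i → g (Fin.suc i))) (g≡𝟘 Fin.zero))
    (trans (+-identityˡ _) (foldr-only-last k (λ i → g (Fin.suc i)) (λ i → g≡𝟘 (Fin.suc i))))

  module Sums {c ℓ} (M : CommutativeMonoid c ℓ) where
    open ListSum M public
    open CommutativeMonoid M using (Carrier; _≈_)

    ∑-select-elems : ∀ c (f : F → Carrier) → ∑ elems (λ y → when (does (y ≟ c)) (f y)) ≈ f c
    ∑-select-elems c f = ∑-select _≟_ elems c f elems-unique (elems-complete c)

    ∑-translate : ∀ b (f : F → Carrier) → ∑ elems (λ x → f (x ⊕ b)) ≈ ∑ elems f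
    ∑-translate b = ∑-reindex _≟_ elems elems-unique elems-complete
      (_⊕ b) (_⊕ ⊖ b) (λ y → x⊖y⊕y≡x y b) (λ x → x⊕y⊖y≡x x b)

    ∑-scale : ∀ {a} → ¬ a ≡ 𝟘 → (f : F → Carrier) → ∑ elems (λ x → f (a ⊗ x)) ≈ ∑ elems f
    ∑-scale a≢𝟘 = ∑-reindex _≟_ elems elems-unique elems-complete
      _ _ (⊗-inv-cancelˡ a≢𝟘) (inv-⊗-cancelˡ a≢𝟘)

  module ∑F = Sums (CommutativeRing.+-commutativeMonoid ring)
  module ∏F = Sums (CommutativeRing.*-commutativeMonoid ring)

  ∑F-𝟙 : ∀ (l : List F) → ∑F.∑ l (λ _ → 𝟙) ≡ natF (length l)
  ∑F-𝟙 []      = refl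
  ∑F-𝟙 (x ∷ l) = cong (𝟙 ⊕_) (∑F-𝟙 l)

  ∏F-const : ∀ (l : List F) a → ∏F.∑ l (λ _ → a) ≡ powF a (length l)
  ∏F-const []      a = refl
  ∏F-const (x ∷ l) a = cong (a ⊗_) (∏F-const l a)

  natF-card≡𝟘 : natF (length elems) ≡ 𝟘
  natF-card≡𝟘 = ⊕-cancelʳ S (begin
    natF (length elems) ⊕ S                ≡⟨ +-comm _ S ⟩
    S ⊕ natF (length elems)                ≡⟨ cong (S ⊕_) (∑F-𝟙 elems) ⟨
    S ⊕ ∑F.∑ elems (λ _ → 𝟙)               ≡⟨ ∑F.∑-∙ elems (λ x → x) (λ _ → 𝟙) ⟨
    ∑F.∑ elems (λ x → x ⊕ 𝟙)               ≡⟨ ∑F.∑-translate 𝟙 (λ x → x) ⟩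
    S                                      ≡⟨ +-identityˡ S ⟨
    𝟘 ⊕ S                                  ∎)
    where
    S : F
    S = ∑F.∑ elems (λ x → x)

  powF-𝟘-length : ∀ {l : List F} {x} → x ∈ l → powF 𝟘 (length l) ≡ 𝟘
  powF-𝟘-length {_ ∷ _} _ = zeroˡ _

  -- Fermat: x ↦ a x permutes the nonzero elements, so a^(|F|-1) times their product is their product.
  powF-card : ∀ a → powF a (length elems) ≡ a
  powF-card a with a ≟ 𝟘
  ... | yes refl = powF-𝟘-length (elems-complete 𝟘)
  ... | no  a≢𝟘 = begin
    powF a (length elems)              ≡⟨ ∏F-const elems a ⟨
    ∏ (λ _ → a)                        ≡⟨ ∏F.∑-cong elems a≡ah·ak ⟩
    ∏ (λ x → ah x ⊗ ak x)              ≡⟨ ∏F.∑-∙ elems ah ak ⟩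
    ∏ ah ⊗ ∏ ak                        ≡⟨ cong₂ _⊗_ ∏ah≡𝟙 (∏F.∑-select-elems 𝟘 (λ _ → a)) ⟩
    𝟙 ⊗ a                              ≡⟨ *-identityˡ a ⟩
    a                                  ∎
    where
    ∏ : (F → F) → F
    ∏ = ∏F.∑ elems
    unit ah ak : F → F
    unit x = if does (x ≟ 𝟘) then 𝟙 else x
    ah x   = if does (x ≟ 𝟘) then 𝟙 else a
    ak x   = ∏F.when (does (x ≟ 𝟘)) a
    a≡ah·ak : ∀ x → a ≡ ah x ⊗ ak x
    a≡ah·ak x with x ≟ 𝟘
    ... | yes _ = sym (*-identityˡ a)
    ... | no  _ = sym (*-identityʳ a)
    unit-≢𝟘 : ∀ x → ¬ unit x ≡ 𝟘
    unit-≢𝟘 x with x ≟ 𝟘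
    ... | yes _   = 𝟙≢𝟘
    ... | no  x≢𝟘 = x≢𝟘
    ∏unit-≢𝟘 : ∀ l → ¬ ∏F.∑ l unit ≡ 𝟘
    ∏unit-≢𝟘 []      = 𝟙≢𝟘
    ∏unit-≢𝟘 (x ∷ l) = ⊗-≢𝟘 (unit-≢𝟘 x) (∏unit-≢𝟘 l)
    unit-scale : ∀ x → unit (a ⊗ x) ≡ ah x ⊗ unit x
    unit-scale x with x ≟ 𝟘 | (a ⊗ x) ≟ 𝟘
    ... | yes _    | yes _     = sym (*-identityˡ 𝟙)
    ... | yes refl | no ax≢𝟘   = ⊥-elim (ax≢𝟘 (zeroʳ a))
    ... | no  x≢𝟘  | yes ax≡𝟘  = ⊥-elim (⊗-≢𝟘 a≢𝟘 x≢𝟘 ax≡𝟘)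
    ... | no  _    | no  _     = refl
    ∏ah≡𝟙 : ∏ ah ≡ 𝟙
    ∏ah≡𝟙 = ⊗-cancelʳ (∏unit-≢𝟘 elems) (begin
      ∏ ah ⊗ ∏ unit                  ≡⟨ ∏F.∑-∙ elems ah unit ⟨
      ∏ (λ x → ah x ⊗ unit x)        ≡⟨ ∏F.∑-cong elems unit-scale ⟨
      ∏ (λ x → unit (a ⊗ x))         ≡⟨ ∏F.∑-scale a≢𝟘 unit ⟩
      ∏ unit                         ≡⟨ *-identityˡ _ ⟨
      𝟙 ⊗ ∏ unit                     ∎)

  eval : List F → F → F
  eval []       x = 𝟘
  eval (c ∷ cs) x = c ⊕ x ⊗ eval cs x

  -- monic (c₀ ∷ … ∷ cₙ₋₁) is the polynomial xⁿ + cₙ₋₁ xⁿ⁻¹ + … + c₀.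
  monic : List F → F → F
  monic cs x = powF x (length cs) ⊕ eval cs x

  eval-replicate-𝟘 : ∀ n x → eval (replicate n 𝟘) x ≡ 𝟘
  eval-replicate-𝟘 zero    x = refl
  eval-replicate-𝟘 (suc n) x = trans (cong (λ t → 𝟘 ⊕ x ⊗ t) (eval-replicate-𝟘 n x)) (trans (+-identityˡ _) (zeroʳ x))

  eval-++ : ∀ as bs x → eval (as ++ bs) x ≡ eval as x ⊕ powF x (length as) ⊗ eval bs x
  eval-++ []       bs x = sym (trans (+-identityˡ _) (*-identityˡ _))
  eval-++ (a ∷ as) bs x = begin
    a ⊕ x ⊗ eval (as ++ bs) x
      ≡⟨ cong (λ t → a ⊕ x ⊗ t) (eval-++ as bs x) ⟩
    a ⊕ x ⊗ (eval as x ⊕ powF x (length as) ⊗ eval bs x)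
      ≡⟨ solve 5 (λ a x A P E → a :+ x :* (A :+ P :* E) := (a :+ x :* A) :+ (x :* P) :* E) refl a x _ _ _ ⟩
    (a ⊕ x ⊗ eval as x) ⊕ (x ⊗ powF x (length as)) ⊗ eval bs x ∎

  monic-∷ : ∀ c cs x → monic (c ∷ cs) x ≡ c ⊕ x ⊗ monic cs x
  monic-∷ c cs x = solve 4 (λ x P c E → x :* P :+ (c :+ x :* E) := c :+ x :* (P :+ E)) refl x (powF x (length cs)) c (eval cs x)

  -- synthetic division of monic (c ∷ cs) by x - r: the quotient's coefficients and the remainder
  divide : F → F → List F → List F × F
  divide r c []        = [] , c ⊕ r
  divide r c (c′ ∷ cs) with divide r c′ cs
  ... | qs , s = s ∷ qs , c ⊕ r ⊗ s

  divide-length : ∀ r c cs → length (proj₁ (divide r c cs)) ≡ length cs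
  divide-length r c []        = refl
  divide-length r c (c′ ∷ cs) = cong suc (divide-length r c′ cs)

  divide-correct : ∀ r c cs x →
    monic (c ∷ cs) x ≡ (x ⊕ ⊖ r) ⊗ monic (proj₁ (divide r c cs)) x ⊕ proj₂ (divide r c cs)
  divide-correct r c [] x =
    solve 3 (λ x r c → x :* con (+ 1) :+ (c :+ x :* con (+ 0)) := (x :- r) :* (con (+ 1) :+ con (+ 0)) :+ (c :+ r)) refl x r c
  divide-correct r c (c′ ∷ cs) x = begin
    monic (c ∷ c′ ∷ cs) x
      ≡⟨ monic-∷ c (c′ ∷ cs) x ⟩
    c ⊕ x ⊗ monic (c′ ∷ cs) x
      ≡⟨ cong (λ t → c ⊕ x ⊗ t) (divide-correct r c′ cs x) ⟩
    c ⊕ x ⊗ ((x ⊕ ⊖ r) ⊗ monic qs x ⊕ s)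
      ≡⟨ solve 5 (λ c x r Q s → c :+ x :* ((x :- r) :* Q :+ s) := (x :- r) :* (s :+ x :* Q) :+ (c :+ r :* s)) refl c x r (monic qs x) s ⟩
    (x ⊕ ⊖ r) ⊗ (s ⊕ x ⊗ monic qs x) ⊕ (c ⊕ r ⊗ s)
      ≡⟨ cong (λ t → (x ⊕ ⊖ r) ⊗ t ⊕ (c ⊕ r ⊗ s)) (monic-∷ s qs x) ⟨
    (x ⊕ ⊖ r) ⊗ monic (s ∷ qs) x ⊕ (c ⊕ r ⊗ s)         ∎
    where
    qs : List F
    qs = proj₁ (divide r c′ cs)
    s : F
    s = proj₂ (divide r c′ cs)

  monic-roots-bound : ∀ cs rs → Unique rs → All (λ r → monic cs r ≡ 𝟘) rs → length rs ≤ length cs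
  monic-roots-bound cs [] _ _ = z≤n
  monic-roots-bound [] (r ∷ rs) _ (𝟙⊕𝟘≡𝟘 ∷ _) = ⊥-elim (𝟙≢𝟘 (trans (sym (+-identityʳ 𝟙)) 𝟙⊕𝟘≡𝟘))
  monic-roots-bound (c ∷ cs) (r ∷ rs) (r∉rs ∷ u) (root ∷ roots) =
      s≤s (subst (length rs ≤_) (divide-length r c cs) (monic-roots-bound qs rs u (quotient-roots rs r∉rs roots)))
    where
    qs : List F
    qs = proj₁ (divide r c cs)
    s : F
    s = proj₂ (divide r c cs)
    factor : ∀ x → monic (c ∷ cs) x ≡ (x ⊕ ⊖ r) ⊗ monic qs x ⊕ s
    factor = divide-correct r c cs
    s≡𝟘 : s ≡ 𝟘
    s≡𝟘 = begin
      s                                ≡⟨ +-identityˡ s ⟨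
      𝟘 ⊕ s                            ≡⟨ cong (_⊕ s) (zeroˡ (monic qs r)) ⟨
      𝟘 ⊗ monic qs r ⊕ s               ≡⟨ cong (λ t → t ⊗ monic qs r ⊕ s) (-‿inverseʳ r) ⟨
      (r ⊕ ⊖ r) ⊗ monic qs r ⊕ s       ≡⟨ factor r ⟨
      monic (c ∷ cs) r                 ≡⟨ root ⟩
      𝟘                                ∎
    quotient-roots : ∀ xs → All (λ x → ¬ r ≡ x) xs → All (λ x → monic (c ∷ cs) x ≡ 𝟘) xs → All (λ x → monic qs x ≡ 𝟘) xs
    quotient-roots []       _              _              = []
    quotient-roots (x ∷ xs) (r≢x ∷ r≢xs) (root-x ∷ roots) with zero-product (x ⊕ ⊖ r) (monic qs x) product≡𝟘
      where
      product≡𝟘 : (x ⊕ ⊖ r) ⊗ monic qs x ≡ 𝟘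
      product≡𝟘 = begin
        (x ⊕ ⊖ r) ⊗ monic qs x          ≡⟨ +-identityʳ _ ⟨
        (x ⊕ ⊖ r) ⊗ monic qs x ⊕ 𝟘      ≡⟨ cong ((x ⊕ ⊖ r) ⊗ monic qs x ⊕_) s≡𝟘 ⟨
        (x ⊕ ⊖ r) ⊗ monic qs x ⊕ s      ≡⟨ factor x ⟨
        monic (c ∷ cs) x                ≡⟨ root-x ⟩
        𝟘                               ∎
    ... | inj₁ x⊖r≡𝟘 = ⊥-elim (r≢x (sym (trans (sym (x⊖y⊕y≡x x r)) (trans (cong (_⊕ r) x⊖r≡𝟘) (+-identityˡ r)))))
    ... | inj₂ q≡𝟘   = q≡𝟘 ∷ quotient-roots xs r≢xs roots

  Square : F → Set
  Square x = Σ F λ s → s ⊗ s ≡ x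

  isSquare⇒Square : ∀ x → isSquare x ≡ true → Square x
  isSquare⇒Square x = search elems
    where
    search : ∀ l → any (λ y → ⌊ (y ⊗ y) ≟ x ⌋) l ≡ true → Square x
    search (y ∷ l) found with (y ⊗ y) ≟ x
    ... | yes y²≡x = y , y²≡x
    ... | no  _    = search l found

  Square⇒isSquare : ∀ x → Square x → isSquare x ≡ true
  Square⇒isSquare x (s , s²≡x) = search elems (elems-complete s)
    where
    search : ∀ l → s ∈ l → any (λ y → ⌊ (y ⊗ y) ≟ x ⌋) l ≡ true
    search (y ∷ l) s∈ with (y ⊗ y) ≟ x
    ... | yes _    = refl
    ... | no  y²≢x with s∈
    ...   | here refl = ⊥-elim (y²≢x s²≡x)
    ...   | there s∈l = search l s∈l

  isSquare≡false⇒¬Square : ∀ x → isSquare x ≡ false → ¬ Square x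
  isSquare≡false⇒¬Square x isSquare≡false sq with () ← trans (sym isSquare≡false) (Square⇒isSquare x sq)

  Square-cancel : ∀ G {s t} → ¬ s ≡ 𝟘 → t ⊗ t ≡ G ⊗ (s ⊗ s) → Square G
  Square-cancel G {s} {t} s≢𝟘 t²≡Gs² = t ⊗ inv s , (begin
    (t ⊗ inv s) ⊗ (t ⊗ inv s)
      ≡⟨ solve 2 (λ t i → (t :* i) :* (t :* i) := (t :* t) :* (i :* i)) refl t (inv s) ⟩
    (t ⊗ t) ⊗ (inv s ⊗ inv s)
      ≡⟨ cong (_⊗ (inv s ⊗ inv s)) t²≡Gs² ⟩
    (G ⊗ (s ⊗ s)) ⊗ (inv s ⊗ inv s)
      ≡⟨ solve 3 (λ G s i → (G :* (s :* s)) :* (i :* i) := G :* ((s :* i) :* (s :* i))) refl G s (inv s) ⟩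
    G ⊗ ((s ⊗ inv s) ⊗ (s ⊗ inv s))
      ≡⟨ cong (λ u → G ⊗ (u ⊗ u)) (inv-inverseʳ s≢𝟘) ⟩
    G ⊗ (𝟙 ⊗ 𝟙)
      ≡⟨ solve 1 (λ G → G :* (con (+ 1) :* con (+ 1)) := G) refl G ⟩
    G                                    ∎)

  square-roots : ∀ b s → b ⊗ b ≡ s ⊗ s → b ≡ s ⊎ b ≡ ⊖ s
  square-roots b s b²≡s² with zero-product (b ⊕ ⊖ s) (b ⊕ s) product≡𝟘
    where
    product≡𝟘 : (b ⊕ ⊖ s) ⊗ (b ⊕ s) ≡ 𝟘
    product≡𝟘 = begin
      (b ⊕ ⊖ s) ⊗ (b ⊕ s)    ≡⟨ solve 2 (λ b s → (b :- s) :* (b :+ s) := b :* b :- s :* s) refl b s ⟩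
      b ⊗ b ⊕ ⊖ (s ⊗ s)      ≡⟨ cong (_⊕ ⊖ (s ⊗ s)) b²≡s² ⟩
      s ⊗ s ⊕ ⊖ (s ⊗ s)      ≡⟨ -‿inverseʳ (s ⊗ s) ⟩
      𝟘                      ∎
  ... | inj₁ b⊖s≡𝟘 = inj₁ (trans (sym (x⊖y⊕y≡x b s)) (trans (cong (_⊕ s) b⊖s≡𝟘) (+-identityˡ s)))
  ... | inj₂ b⊕s≡𝟘 = inj₂ (trans (sym (x⊕y⊖y≡x b s)) (trans (cong (_⊕ ⊖ s) b⊕s≡𝟘) (+-identityˡ (⊖ s))))

  module OddCharacteristic (two≢𝟘 : ¬ two ≡ 𝟘) where

    ≢⊖-self : ∀ {s} → ¬ s ≡ 𝟘 → ¬ s ≡ ⊖ s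
    ≢⊖-self {s} s≢𝟘 s≡⊖s = ⊗-≢𝟘 two≢𝟘 s≢𝟘 (begin
      two ⊗ s      ≡⟨ solve 1 (λ s → :two :* s := s :+ s) refl s ⟩
      s ⊕ s        ≡⟨ cong (s ⊕_) s≡⊖s ⟩
      s ⊕ ⊖ s      ≡⟨ -‿inverseʳ s ⟩
      𝟘            ∎)

    module Fibers {c ℓ} (M : CommutativeMonoid c ℓ) where
      open Sums M
      open CommutativeMonoid M hiding (refl; sym; trans)
      open CommutativeMonoid M using () renaming (refl to ≈-refl; sym to ≈-sym; trans to ≈-trans)
      open import Relation.Binary.Reasoning.Setoid setoid renaming (begin_ to beginₘ_; _∎ to _∎ₘ)

      fiber : F → F → Carrier → Carrier
      fiber G y v = ∑ elems (λ b → when (does (y ≟ (G ⊗ (b ⊗ b)))) v)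

      fiber-𝟘 : ∀ {G} → ¬ G ≡ 𝟘 → ∀ v → fiber G 𝟘 v ≈ v
      fiber-𝟘 {G} G≢𝟘 v = ≈-trans (∑-cong elems only-𝟘) (∑-select-elems 𝟘 (λ _ → v))
        where
        only-𝟘 : ∀ b → when (does (𝟘 ≟ (G ⊗ (b ⊗ b)))) v ≈ when (does (b ≟ 𝟘)) v
        only-𝟘 b with 𝟘 ≟ (G ⊗ (b ⊗ b)) | b ≟ 𝟘
        ... | yes _    | yes _   = ≈-refl
        ... | no  _    | no  _   = ≈-refl
        ... | yes 𝟘≡Gb² | no b≢𝟘 = ⊥-elim (⊗-≢𝟘 G≢𝟘 (⊗-≢𝟘 b≢𝟘 b≢𝟘) (sym 𝟘≡Gb²))
        ... | no 𝟘≢Gb² | yes refl = ⊥-elim (𝟘≢Gb² (sym (trans (cong (G ⊗_) (zeroʳ 𝟘)) (zeroʳ G))))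

      fiber-square : ∀ {G s y} → ¬ G ≡ 𝟘 → ¬ s ≡ 𝟘 → y ≡ G ⊗ (s ⊗ s) → ∀ v → fiber G y v ≈ v ∙ v
      fiber-square {G} {s} G≢𝟘 s≢𝟘 refl v = beginₘ
        fiber G (G ⊗ (s ⊗ s)) v
          ≈⟨ ∑-cong elems ±s ⟩
        ∑ elems (λ b → when (does (b ≟ s)) v ∙ when (does (b ≟ (⊖ s))) v)
          ≈⟨ ∑-∙ elems _ _ ⟩
        ∑ elems (λ b → when (does (b ≟ s)) v) ∙ ∑ elems (λ b → when (does (b ≟ (⊖ s))) v)
          ≈⟨ ∙-cong (∑-select-elems s (λ _ → v)) (∑-select-elems (⊖ s) (λ _ → v)) ⟩
        v ∙ v ∎ₘ
        where
        ±s : ∀ b → when (does ((G ⊗ (s ⊗ s)) ≟ (G ⊗ (b ⊗ b)))) v ≈ when (does (b ≟ s)) v ∙ when (does (b ≟ (⊖ s))) v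
        ±s b with (G ⊗ (s ⊗ s)) ≟ (G ⊗ (b ⊗ b)) | b ≟ s | b ≟ (⊖ s)
        ... | _ | yes refl | yes b≡⊖b = ⊥-elim (≢⊖-self s≢𝟘 b≡⊖b)
        ... | yes _ | yes _ | no _  = ≈-sym (identityʳ v)
        ... | yes _ | no _  | yes _ = ≈-sym (identityˡ v)
        ... | yes Gs²≡Gb² | no b≢s | no b≢⊖s
            with square-roots b s (⊗-cancelʳ G≢𝟘 (trans (*-comm _ G) (trans (sym Gs²≡Gb²) (*-comm G _))))
        ...   | inj₁ b≡s  = ⊥-elim (b≢s b≡s)
        ...   | inj₂ b≡⊖s = ⊥-elim (b≢⊖s b≡⊖s)
        ±s b | no Gs²≢Gb² | yes refl | no _ = ⊥-elim (Gs²≢Gb² refl)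
        ±s b | no Gs²≢Gb² | no _ | yes refl = ⊥-elim (Gs²≢Gb² (cong (G ⊗_) (solve 1 (λ s → s :* s := (:- s) :* (:- s)) refl s)))
        ±s b | no _ | no _ | no _ = ≈-sym (identityˡ ε)

      fiber-empty : ∀ {G y} → (∀ b → ¬ y ≡ G ⊗ (b ⊗ b)) → ∀ v → fiber G y v ≈ ε
      fiber-empty {G} {y} no-solution v = ≈-trans (∑-cong elems none) (∑-ε elems)
        where
        none : ∀ b → when (does (y ≟ (G ⊗ (b ⊗ b)))) v ≈ ε
        none b with y ≟ (G ⊗ (b ⊗ b))
        ... | yes y≡Gb² = ⊥-elim (no-solution b y≡Gb²)
        ... | no  _     = ≈-refl

    data SquareClass (y : F) : Set where
      zero      : y ≡ 𝟘 → SquareClass y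
      square    : ¬ y ≡ 𝟘 → Square y → SquareClass y
      nonsquare : ¬ y ≡ 𝟘 → ¬ Square y → SquareClass y

    classify : ∀ y → SquareClass y
    classify y with y ≟ 𝟘 | isSquare y in isSquare≡
    ... | yes y≡𝟘 | _     = zero y≡𝟘
    ... | no  y≢𝟘 | true  = square y≢𝟘 (isSquare⇒Square y isSquare≡)
    ... | no  y≢𝟘 | false = nonsquare y≢𝟘 (isSquare≡false⇒¬Square y isSquare≡)

    [zero] [square] [nonsquare] : ∀ {y} → SquareClass y → ℕ
    [zero] (zero _) = 1
    [zero] _        = 0
    [square] (square _ _) = 1
    [square] _            = 0
    [nonsquare] (nonsquare _ _) = 1
    [nonsquare] _               = 0

    private
      module Fℕ = Fibers ℕP.+-0-commutativeMonoid
      open Sums ℕP.+-0-commutativeMonoid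
      open ListSumℕ using (≤-∑-≡⇒≡)

    #square-roots : ∀ y → Fℕ.fiber 𝟙 y 1 ≡ [zero] (classify y) ℕ.+ ([square] (classify y) ℕ.+ [square] (classify y))
    #square-roots y with classify y
    ... | zero refl               = Fℕ.fiber-𝟘 𝟙≢𝟘 1
    ... | square y≢𝟘 (s , s²≡y)   = Fℕ.fiber-square 𝟙≢𝟘 s≢𝟘 (sym (trans (*-identityˡ _) s²≡y)) 1
      where
      s≢𝟘 : ¬ s ≡ 𝟘
      s≢𝟘 refl = y≢𝟘 (trans (sym s²≡y) (zeroʳ 𝟘))
    ... | nonsquare _ ¬square     = Fℕ.fiber-empty (λ b y≡b² → ¬square (b , trans (sym (*-identityˡ _)) (sym y≡b²))) 1

    #classes : ∀ y → 1 ≡ [zero] (classify y) ℕ.+ ([square] (classify y) ℕ.+ [nonsquare] (classify y))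
    #classes y with classify y
    ... | zero _        = refl
    ... | square _ _    = refl
    ... | nonsquare _ _ = refl

    -- Counting the pairs (b, b²) in two ways: 1 + 2·#squares = |F| = 1 + #squares + #nonsquares.
    #squares≡#nonsquares : ∑ elems (λ y → [square] (classify y)) ≡ ∑ elems (λ y → [nonsquare] (classify y))
    #squares≡#nonsquares = ℕP.+-cancelˡ-≡ A A B (ℕP.+-cancelˡ-≡ 1 _ _ (begin
      1 ℕ.+ (A ℕ.+ A)
        ≡⟨ cong₂ ℕ._+_ (sym #zero) (sym (∑-∙ elems sq sq)) ⟩
      ∑ elems zr ℕ.+ ∑ elems (λ y → sq y ℕ.+ sq y)
        ≡⟨ ∑-∙ elems zr _ ⟨
      ∑ elems (λ y → zr y ℕ.+ (sq y ℕ.+ sq y))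
        ≡⟨ ∑-cong elems #square-roots ⟨
      ∑ elems (λ y → Fℕ.fiber 𝟙 y 1)
        ≡⟨ ∑-swap elems elems _ ⟩
      ∑ elems (λ b → ∑ elems (λ y → when (does (y ≟ (𝟙 ⊗ (b ⊗ b)))) 1))
        ≡⟨ ∑-cong elems (λ b → ∑-select-elems (𝟙 ⊗ (b ⊗ b)) (λ _ → 1)) ⟩
      ∑ elems (λ _ → 1)
        ≡⟨ ∑-cong elems #classes ⟩
      ∑ elems (λ y → zr y ℕ.+ (sq y ℕ.+ nsq y))
        ≡⟨ ∑-∙ elems zr _ ⟩
      ∑ elems zr ℕ.+ ∑ elems (λ y → sq y ℕ.+ nsq y)
        ≡⟨ cong₂ ℕ._+_ #zero (∑-∙ elems sq nsq) ⟩
      1 ℕ.+ (A ℕ.+ B)                                 ∎))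
      where
      zr sq nsq : F → ℕ
      zr y  = [zero] (classify y)
      sq y  = [square] (classify y)
      nsq y = [nonsquare] (classify y)
      A B : ℕ
      A = ∑ elems sq
      B = ∑ elems nsq
      #zero : ∑ elems zr ≡ 1
      #zero = trans (∑-cong elems zero-indicator) (∑-select-elems 𝟘 (λ _ → 1))
        where
        indicator-≡ : ∀ {y} → y ≡ 𝟘 → when (does (y ≟ 𝟘)) 1 ≡ 1
        indicator-≡ {y} y≡𝟘 with y ≟ 𝟘
        ... | yes _   = refl
        ... | no y≢𝟘 = ⊥-elim (y≢𝟘 y≡𝟘)
        indicator-≢ : ∀ {y} → ¬ y ≡ 𝟘 → when (does (y ≟ 𝟘)) 1 ≡ 0
        indicator-≢ {y} y≢𝟘 with y ≟ 𝟘
        ... | yes y≡𝟘 = ⊥-elim (y≢𝟘 y≡𝟘)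
        ... | no _    = refl
        zero-indicator : ∀ y → zr y ≡ when (does (y ≟ 𝟘)) 1
        zero-indicator y with classify y
        ... | zero y≡𝟘        = sym (indicator-≡ y≡𝟘)
        ... | square y≢𝟘 _    = sym (indicator-≢ y≢𝟘)
        ... | nonsquare y≢𝟘 _ = sym (indicator-≢ y≢𝟘)

    -- Multiplication by a nonsquare H maps squares into nonsquares; as both classes
    -- have the same size, it maps them onto the nonsquares.
    square↦nonsquare : ∀ {H} → ¬ H ≡ 𝟘 → ¬ Square H →
                       All (λ x → [square] (classify x) ≡ [nonsquare] (classify (H ⊗ x))) elems
    square↦nonsquare {H} H≢𝟘 ¬sqH = ≤-∑-≡⇒≡ elems sq nsq sq≤nsq
      (trans #squares≡#nonsquares (sym (∑-scale H≢𝟘 (λ x → [nonsquare] (classify x)))))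
      where
      sq nsq : F → ℕ
      sq  x = [square] (classify x)
      nsq x = [nonsquare] (classify (H ⊗ x))
      sq≤nsq : ∀ x → sq x ≤ nsq x
      sq≤nsq x with classify x
      ... | zero _        = z≤n
      ... | nonsquare _ _ = z≤n
      ... | square x≢𝟘 (s , s²≡x) with classify (H ⊗ x)
      ...   | zero Hx≡𝟘        = ⊥-elim (⊗-≢𝟘 H≢𝟘 x≢𝟘 Hx≡𝟘)
      ...   | nonsquare _ _    = s≤s z≤n
      ...   | square _ (t , t²≡Hx) = ⊥-elim (¬sqH (Square-cancel H s≢𝟘 (trans t²≡Hx (cong (H ⊗_) (sym s²≡x)))))
        where
        s≢𝟘 : ¬ s ≡ 𝟘
        s≢𝟘 refl = x≢𝟘 (trans (sym s²≡x) (zeroʳ 𝟘))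

    nonsquare-⊗-nonsquare : ∀ {H y} → ¬ H ≡ 𝟘 → ¬ Square H → ¬ y ≡ 𝟘 → ¬ Square y → Square (H ⊗ y)
    nonsquare-⊗-nonsquare {H} {y} H≢𝟘 ¬sqH y≢𝟘 ¬sqy
      with All.lookup (square↦nonsquare H≢𝟘 ¬sqH) (elems-complete y)
    ... | sq≡nsq with classify y
    ...   | zero y≡𝟘        = ⊥-elim (y≢𝟘 y≡𝟘)
    ...   | square _ sqy    = ⊥-elim (¬sqy sqy)
    ...   | nonsquare _ _ with classify (H ⊗ y)
    ...     | zero Hy≡𝟘      = ⊥-elim (⊗-≢𝟘 H≢𝟘 y≢𝟘 Hy≡𝟘)
    ...     | square _ sqHy  = sqHy
    ...     | nonsquare _ _ with () ← sq≡nsq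

    module _ {c ℓ} (M : CommutativeMonoid c ℓ) where
      open CommutativeMonoid M using (_≈_; _∙_; ∙-cong; identityˡ; identityʳ) renaming (trans to ≈-trans)
      open Fibers M

      -- b² = y has two solutions when y is a nonzero square, G b² = y has two when it is not.
      fiber-nonsquare-∙-fiber-𝟙 : ∀ {G} → ¬ G ≡ 𝟘 → ¬ Square G → ∀ y v → fiber G y v ∙ fiber 𝟙 y v ≈ v ∙ v
      fiber-nonsquare-∙-fiber-𝟙 {G} G≢𝟘 ¬sqG y v with classify y
      ... | zero refl = ∙-cong (fiber-𝟘 G≢𝟘 v) (fiber-𝟘 𝟙≢𝟘 v)
      ... | square y≢𝟘 (s , s²≡y) =
            ≈-trans (∙-cong (fiber-empty no-root v) (fiber-square 𝟙≢𝟘 s≢𝟘 (sym (trans (*-identityˡ _) s²≡y)) v)) (identityˡ _)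
        where
        s≢𝟘 : ¬ s ≡ 𝟘
        s≢𝟘 refl = y≢𝟘 (trans (sym s²≡y) (zeroʳ 𝟘))
        no-root : ∀ b → ¬ y ≡ G ⊗ (b ⊗ b)
        no-root b y≡Gb² = ¬sqG (Square-cancel G b≢𝟘 (trans s²≡y y≡Gb²))
          where
          b≢𝟘 : ¬ b ≡ 𝟘
          b≢𝟘 refl = y≢𝟘 (trans y≡Gb² (trans (cong (G ⊗_) (zeroʳ 𝟘)) (zeroʳ G)))
      ... | nonsquare y≢𝟘 ¬sqy with nonsquare-⊗-nonsquare G≢𝟘 ¬sqG y≢𝟘 ¬sqy
      ...   | u , u²≡Gy =
            ≈-trans (∙-cong (fiber-square G≢𝟘 t≢𝟘 y≡Gt² v) (fiber-empty no-root v)) (identityʳ _)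
        where
        t : F
        t = u ⊗ inv G
        y≡Gt² : y ≡ G ⊗ (t ⊗ t)
        y≡Gt² = sym (begin
          G ⊗ (t ⊗ t)
            ≡⟨ solve 3 (λ G u i → G :* ((u :* i) :* (u :* i)) := ((u :* u) :* i) :* (G :* i)) refl G u (inv G) ⟩
          ((u ⊗ u) ⊗ inv G) ⊗ (G ⊗ inv G)
            ≡⟨ cong₂ (λ a b → (a ⊗ inv G) ⊗ b) u²≡Gy (inv-inverseʳ G≢𝟘) ⟩
          ((G ⊗ y) ⊗ inv G) ⊗ 𝟙
            ≡⟨ solve 3 (λ G y i → ((G :* y) :* i) :* con (+ 1) := y :* (G :* i)) refl G y (inv G) ⟩
          y ⊗ (G ⊗ inv G)
            ≡⟨ cong (y ⊗_) (inv-inverseʳ G≢𝟘) ⟩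
          y ⊗ 𝟙
            ≡⟨ *-identityʳ y ⟩
          y                                  ∎)
        t≢𝟘 : ¬ t ≡ 𝟘
        t≢𝟘 t≡𝟘 = y≢𝟘 (trans y≡Gt² (trans (cong (λ x → G ⊗ (x ⊗ x)) t≡𝟘) (trans (cong (G ⊗_) (zeroʳ 𝟘)) (zeroʳ G))))
        no-root : ∀ b → ¬ y ≡ 𝟙 ⊗ (b ⊗ b)
        no-root b y≡b² = ¬sqy (b , trans (sym (*-identityˡ _)) (sym y≡b²))

[1+k]*[1+n]C[1+k]≡[1+n]*nCk : ∀ n k → suc k ℕ.* (suc n C suc k) ≡ suc n ℕ.* (n C k)
[1+k]*[1+n]C[1+k]≡[1+n]*nCk zero    zero    = refl
[1+k]*[1+n]C[1+k]≡[1+n]*nCk zero    (suc k) = trans (ℕP.*-zeroʳ (suc (suc k))) (sym (k>n⇒nCk≡0 {0} {suc k} (s≤s z≤n)))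
[1+k]*[1+n]C[1+k]≡[1+n]*nCk (suc n) zero    = trans (ℕP.*-identityˡ _) (trans (nC1≡n (suc (suc n))) (sym (ℕP.*-identityʳ (suc (suc n)))))
[1+k]*[1+n]C[1+k]≡[1+n]*nCk (suc n) (suc k) = begin
  suc (suc k) ℕ.* (suc (suc n) C suc (suc k))
    ≡⟨ cong (suc (suc k) ℕ.*_) (nCk+nC[k+1]≡[n+1]C[k+1] (suc n) (suc k)) ⟨
  suc (suc k) ℕ.* (A ℕ.+ B)
    ≡⟨ solve 3 (λ k A B → (con 2 :+ k) :* (A :+ B) := ((con 1 :+ k) :* A :+ A) :+ (con 2 :+ k) :* B) refl k A B ⟩
  (suc k ℕ.* A ℕ.+ A) ℕ.+ suc (suc k) ℕ.* B
    ≡⟨ cong₂ (λ u v → (u ℕ.+ A) ℕ.+ v) ([1+k]*[1+n]C[1+k]≡[1+n]*nCk n k) ([1+k]*[1+n]C[1+k]≡[1+n]*nCk n (suc k)) ⟩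
  (suc n ℕ.* a ℕ.+ A) ℕ.+ suc n ℕ.* b
    ≡⟨ solve 4 (λ n a b A → ((con 1 :+ n) :* a :+ A) :+ (con 1 :+ n) :* b := (con 1 :+ n) :* (a :+ b) :+ A) refl n a b A ⟩
  suc n ℕ.* (a ℕ.+ b) ℕ.+ A
    ≡⟨ cong (λ u → suc n ℕ.* u ℕ.+ A) (nCk+nC[k+1]≡[n+1]C[k+1] n k) ⟩
  suc n ℕ.* A ℕ.+ A
    ≡⟨ solve 2 (λ n A → (con 1 :+ n) :* A :+ A := (con 2 :+ n) :* A) refl n A ⟩
  suc (suc n) ℕ.* A                             ∎
  where
  open ≡.≡-Reasoning
  open +-*-Solver
  A B a b : ℕ
  A = suc n C suc k
  B = suc n C suc (suc k)
  a = n C k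
  b = n C suc k

p∣pC[1+k] : ∀ {p} → Prime p → ∀ k → suc k < p → p ∣ p C suc k
p∣pC[1+k] {p} p-prime k sk<p with euclidsLemma (suc k) (p C suc k) p-prime p∣product
  where
  instance
    p-nonZero : NonZero p
    p-nonZero = prime⇒nonZero p-prime
  p∣product : p ∣ suc k ℕ.* (p C suc k)
  p∣product = divides (ℕ.pred p C k)
    (trans (subst (λ n → suc k ℕ.* (n C suc k) ≡ n ℕ.* (ℕ.pred p C k)) (ℕP.suc-pred p) ([1+k]*[1+n]C[1+k]≡[1+n]*nCk (ℕ.pred p) k))
           (ℕP.*-comm p _))
... | inj₁ p∣sk = ⊥-elim (ℕP.<⇒≱ sk<p (∣⇒≤ p∣sk))
... | inj₂ p∣C  = p∣C

module PrimeCharacteristic (FF : FiniteField) (p e : ℕ) (p-prime : Prime p)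
                           (card : length (FiniteField.elems FF) ≡ p ℕ.^ e) where
  open FiniteFieldTheory FF p e public
  open ≡.≡-Reasoning

  instance
    p-nonZero : NonZero p
    p-nonZero = prime⇒nonZero p-prime

  1<p : 1 < p
  1<p = ℕ.nonTrivial⇒n>1 p {{prime⇒nonTrivial p-prime}}

  natF-p≡𝟘 : natF p ≡ 𝟘
  natF-p≡𝟘 = powF≡𝟘⇒≡𝟘 e (trans (powF-natF p e) (trans (cong natF (sym card)) natF-card≡𝟘))

  natF-multiple≡𝟘 : ∀ {n} → p ∣ n → natF n ≡ 𝟘
  natF-multiple≡𝟘 (divides t refl) = trans (natF-* t p) (trans (cong (natF t ⊗_) natF-p≡𝟘) (zeroʳ _))

  -- r is coprime to p, and a Bézout identity x r = 1 + y p (or 1 + x r = y p) gives 0 = 1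
  natF-≢𝟘 : ∀ {r} → 0 < r → r < p → ¬ natF r ≡ 𝟘
  natF-≢𝟘 {r} 0<r r<p natF-r≡𝟘 with coprime-Bézout r⊥p
    where
    instance
      r-nonZero : NonZero r
      r-nonZero = ℕ.>-nonZero 0<r
    r⊥p : Coprime r p
    r⊥p {d} (d∣r , d∣p) with prime⇒irreducible p-prime d∣p
    ... | inj₁ d≡1 = d≡1
    ... | inj₂ refl = ⊥-elim (ℕP.<⇒≱ r<p (∣⇒≤ d∣r))
  ... | Bézout.+- x y 1+yp≡xr = 𝟘≢𝟙 (sym (begin
    𝟙                         ≡⟨ +-identityʳ 𝟙 ⟨
    𝟙 ⊕ 𝟘                     ≡⟨ cong (𝟙 ⊕_) (natF-multiple≡𝟘 (divides y refl)) ⟨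
    natF (1 ℕ.+ y ℕ.* p)      ≡⟨ cong natF 1+yp≡xr ⟩
    natF (x ℕ.* r)            ≡⟨ natF-* x r ⟩
    natF x ⊗ natF r           ≡⟨ cong (natF x ⊗_) natF-r≡𝟘 ⟩
    natF x ⊗ 𝟘                ≡⟨ zeroʳ _ ⟩
    𝟘                         ∎))
  ... | Bézout.-+ x y 1+xr≡yp = 𝟘≢𝟙 (sym (begin
    𝟙                         ≡⟨ +-identityʳ 𝟙 ⟨
    𝟙 ⊕ 𝟘                     ≡⟨ cong (𝟙 ⊕_) (zeroʳ (natF x)) ⟨
    𝟙 ⊕ natF x ⊗ 𝟘            ≡⟨ cong (λ t → 𝟙 ⊕ natF x ⊗ t) natF-r≡𝟘 ⟨
    𝟙 ⊕ natF x ⊗ natF r       ≡⟨ cong (𝟙 ⊕_) (natF-* x r) ⟨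
    natF (1 ℕ.+ x ℕ.* r)      ≡⟨ cong natF 1+xr≡yp ⟩
    natF (y ℕ.* p)            ≡⟨ natF-multiple≡𝟘 (divides y refl) ⟩
    𝟘                         ∎))

  natF≡𝟘⇒≡0 : ∀ {d} → d < p → natF d ≡ 𝟘 → d ≡ 0
  natF≡𝟘⇒≡0 {zero}  _   _          = refl
  natF≡𝟘⇒≡0 {suc d} d<p natF-d≡𝟘 = ⊥-elim (natF-≢𝟘 (s≤s z≤n) d<p natF-d≡𝟘)

  natF-injective-≤ : ∀ {m n} → m ≤ n → n < p → natF n ≡ natF m → n ≡ m
  natF-injective-≤ {m} {n} m≤n n<p eq = trans (sym (ℕP.m+[n∸m]≡n m≤n)) (trans (cong (m ℕ.+_) d≡0) (ℕP.+-identityʳ m))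
    where
    d≡0 : n ℕ.∸ m ≡ 0
    d≡0 = natF≡𝟘⇒≡0 (ℕP.≤-<-trans (ℕP.m∸n≤m n m) n<p) (⊕-cancelʳ (natF m) (begin
      natF (n ℕ.∸ m) ⊕ natF m        ≡⟨ +-comm _ _ ⟩
      natF m ⊕ natF (n ℕ.∸ m)        ≡⟨ natF-+ m _ ⟨
      natF (m ℕ.+ (n ℕ.∸ m))         ≡⟨ cong natF (ℕP.m+[n∸m]≡n m≤n) ⟩
      natF n                         ≡⟨ eq ⟩
      natF m                         ≡⟨ +-identityˡ _ ⟨
      𝟘 ⊕ natF m                     ∎))

  natF-injective : ∀ {m n} → m < p → n < p → natF m ≡ natF n → m ≡ n
  natF-injective {m} {n} m<p n<p eq with ℕP.≤-total m n
  ... | inj₁ m≤n = sym (natF-injective-≤ m≤n n<p (sym eq))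
  ... | inj₂ n≤m = natF-injective-≤ n≤m m<p eq

  natF-% : ∀ n → natF n ≡ natF (n % p)
  natF-% n = begin
    natF n                                       ≡⟨ cong natF (m≡m%n+[m/n]*n n p) ⟩
    natF (n % p ℕ.+ (n / p) ℕ.* p)               ≡⟨ natF-+ (n % p) _ ⟩
    natF (n % p) ⊕ natF ((n / p) ℕ.* p)          ≡⟨ cong (natF (n % p) ⊕_) (natF-multiple≡𝟘 (divides (n / p) refl)) ⟩
    natF (n % p) ⊕ 𝟘                             ≡⟨ +-identityʳ _ ⟩
    natF (n % p)                                 ∎

  natF≡⇒%≡ : ∀ {m n} → natF m ≡ natF n → m % p ≡ n % p
  natF≡⇒%≡ {m} {n} eq = natF-injective (m%n<n m p) (m%n<n n p) (trans (sym (natF-% m)) (trans eq (natF-% n)))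

  p-1 : ℕ
  p-1 = ℕ.pred p

  binomialTerm-first : ∀ x y → Binomial.binomialTerm x y (suc p-1) Fin.zero ≡ powF y p
  binomialTerm-first x y = begin
    Binomial.binomialTerm x y (suc p-1) Fin.zero
      ≡⟨ ·≡natF⊗ 1 (Binomial.binomial x y (suc p-1) Fin.zero) ⟩
    (𝟙 ⊕ 𝟘) ⊗ (𝟙 ⊗ y ^ suc p-1)
      ≡⟨ solve 1 (λ Y → (con (+ 1) :+ con (+ 0)) :* (con (+ 1) :* Y) := Y) refl (y ^ suc p-1) ⟩
    y ^ suc p-1
      ≡⟨ trans (^≡powF y (suc p-1)) (cong (powF y) (ℕP.suc-pred p)) ⟩
    powF y p ∎

  binomialTerm-last : ∀ x y → Binomial.binomialTerm x y (suc p-1) (Fin.suc (Fin.fromℕ p-1)) ≡ powF x p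
  binomialTerm-last x y = begin
    Binomial.binomialTerm x y (suc p-1) (Fin.suc (Fin.fromℕ p-1))
      ≡⟨ ·≡natF⊗ (suc p-1 C suc (Fin.toℕ (Fin.fromℕ p-1))) (Binomial.binomial x y (suc p-1) (Fin.suc (Fin.fromℕ p-1))) ⟩
    natF (suc p-1 C suc (Fin.toℕ (Fin.fromℕ p-1))) ⊗ (x ^ suc (Fin.toℕ (Fin.fromℕ p-1)) ⊗ y ^ (p-1 ℕ.∸ Fin.toℕ (Fin.fromℕ p-1)))
      ≡⟨ cong (λ t → natF (suc p-1 C suc t) ⊗ (x ^ suc t ⊗ y ^ (p-1 ℕ.∸ t))) (FinP.toℕ-fromℕ p-1) ⟩
    natF (suc p-1 C suc p-1) ⊗ (x ^ suc p-1 ⊗ y ^ (p-1 ℕ.∸ p-1))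
      ≡⟨ cong₂ (λ a b → natF a ⊗ (x ^ suc p-1 ⊗ y ^ b)) (nCn≡1 (suc p-1)) (ℕP.n∸n≡0 p-1) ⟩
    (𝟙 ⊕ 𝟘) ⊗ (x ^ suc p-1 ⊗ 𝟙)
      ≡⟨ solve 1 (λ X → (con (+ 1) :+ con (+ 0)) :* (X :* con (+ 1)) := X) refl (x ^ suc p-1) ⟩
    x ^ suc p-1
      ≡⟨ trans (^≡powF x (suc p-1)) (cong (powF x) (ℕP.suc-pred p)) ⟩
    powF x p ∎

  binomialTerm-middle : ∀ x y i → Binomial.binomialTerm x y (suc p-1) (Fin.suc (Fin.inject₁ i)) ≡ 𝟘
  binomialTerm-middle x y i = begin
    Binomial.binomialTerm x y (suc p-1) (Fin.suc (Fin.inject₁ i))   ≡⟨ ·≡natF⊗ (suc p-1 C suc k) b ⟩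
    natF (suc p-1 C suc k) ⊗ b                                      ≡⟨ cong (_⊗ b) (natF-multiple≡𝟘 p∣C) ⟩
    𝟘 ⊗ b                                                         ≡⟨ zeroˡ b ⟩
    𝟘                                                             ∎
    where
    k : ℕ
    k = Fin.toℕ (Fin.inject₁ i)
    b : F
    b = Binomial.binomial x y (suc p-1) (Fin.suc (Fin.inject₁ i))
    1+k<p : suc k < p
    1+k<p = subst (suc k <_) (ℕP.suc-pred p) (s≤s (subst (_< p-1) (sym (FinP.toℕ-inject₁ i)) (FinP.toℕ<n i)))
    p∣C : p ∣ suc p-1 C suc k
    p∣C = subst (λ n → p ∣ n C suc k) (sym (ℕP.suc-pred p)) (p∣pC[1+k] p-prime k 1+k<p)

  frobenius : ∀ x y → powF (x ⊕ y) p ≡ powF x p ⊕ powF y p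
  frobenius x y = begin
    powF (x ⊕ y) p
      ≡⟨ ^≡powF (x ⊕ y) p ⟨
    (x ⊕ y) ^ p
      ≡⟨ Binomial.theorem p x y ⟩
    Binomial.binomialExpansion x y p
      ≡⟨ cong (λ n → Vec.foldr _⊕_ 𝟘 (term n)) (ℕP.suc-pred p) ⟨
    Vec.foldr _⊕_ 𝟘 (term (suc p-1))
      ≡⟨ cong (term (suc p-1) Fin.zero ⊕_) (foldr-only-last p-1 (λ i → term (suc p-1) (Fin.suc i)) (binomialTerm-middle x y)) ⟩
    term (suc p-1) Fin.zero ⊕ term (suc p-1) (Fin.suc (Fin.fromℕ p-1))
      ≡⟨ cong₂ _⊕_ (binomialTerm-first x y) (binomialTerm-last x y) ⟩
    powF y p ⊕ powF x p
      ≡⟨ +-comm _ _ ⟩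
    powF x p ⊕ powF y p ∎
    where
    term : ∀ n → Fin (suc n) → F
    term = Binomial.binomialTerm x y

  frobenius-^ : ∀ i x y → powF (x ⊕ y) (p ℕ.^ i) ≡ powF x (p ℕ.^ i) ⊕ powF y (p ℕ.^ i)
  frobenius-^ zero    x y = solve 2 (λ x y → (x :+ y) :* con (+ 1) := x :* con (+ 1) :+ y :* con (+ 1)) refl x y
  frobenius-^ (suc i) x y = begin
    powF (x ⊕ y) (p ℕ.* p ℕ.^ i)                              ≡⟨ powF-* (x ⊕ y) p (p ℕ.^ i) ⟩
    powF (powF (x ⊕ y) p) (p ℕ.^ i)                           ≡⟨ cong (λ t → powF t (p ℕ.^ i)) (frobenius x y) ⟩
    powF (powF x p ⊕ powF y p) (p ℕ.^ i)                      ≡⟨ frobenius-^ i (powF x p) (powF y p) ⟩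
    powF (powF x p) (p ℕ.^ i) ⊕ powF (powF y p) (p ℕ.^ i)     ≡⟨ cong₂ _⊕_ (powF-* x p (p ℕ.^ i)) (powF-* y p (p ℕ.^ i)) ⟨
    powF x (p ℕ.* p ℕ.^ i) ⊕ powF y (p ℕ.* p ℕ.^ i)           ∎

  powF-𝟘-p : powF 𝟘 p ≡ 𝟘
  powF-𝟘-p = trans (cong (powF 𝟘) (sym (ℕP.suc-pred p))) (powF-𝟘 (ℕ.pred p))

  powF-natF-p : ∀ n → powF (natF n) p ≡ natF n
  powF-natF-p zero    = powF-𝟘-p
  powF-natF-p (suc n) = trans (frobenius 𝟙 (natF n)) (cong₂ _⊕_ (powF-𝟙 p) (powF-natF-p n))

  powF-q : ∀ a → powF a (p ℕ.^ e) ≡ a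
  powF-q a = trans (cong (powF a) (sym card)) (powF-card a)

  xᵖ-x : List F
  xᵖ-x = 𝟘 ∷ ⊖ 𝟙 ∷ replicate (p ℕ.∸ 2) 𝟘

  length-xᵖ-x : length xᵖ-x ≡ p
  length-xᵖ-x = trans (cong (λ t → suc (suc t)) (ListP.length-replicate (p ℕ.∸ 2))) (ℕP.m+[n∸m]≡n 1<p)

  monic-xᵖ-x : ∀ x → monic xᵖ-x x ≡ powF x p ⊕ ⊖ x
  monic-xᵖ-x x = begin
    powF x (length xᵖ-x) ⊕ (𝟘 ⊕ x ⊗ (⊖ 𝟙 ⊕ x ⊗ eval (replicate (p ℕ.∸ 2) 𝟘) x))
      ≡⟨ cong₂ (λ n t → powF x n ⊕ (𝟘 ⊕ x ⊗ (⊖ 𝟙 ⊕ x ⊗ t))) length-xᵖ-x (eval-replicate-𝟘 (p ℕ.∸ 2) x) ⟩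
    powF x p ⊕ (𝟘 ⊕ x ⊗ (⊖ 𝟙 ⊕ x ⊗ 𝟘))
      ≡⟨ solve 2 (λ P x → P :+ (con (+ 0) :+ x :* (:- con (+ 1) :+ x :* con (+ 0))) := P :- x) refl (powF x p) x ⟩
    powF x p ⊕ ⊖ x ∎

  -- The fixed points of x ↦ xᵖ are the p elements natF 0, …, natF (p-1): any further one
  -- would be a (p+1)-th root of xᵖ - x.
  frobenius-fixed⇒natF : ∀ x → powF x p ≡ x → ∃ λ n → n < p × natF n ≡ x
  frobenius-fixed⇒natF x xᵖ≡x with Any.any? (λ n → natF n ≟ x) (upTo p)
  ... | yes hit with n , n∈ , natF-n≡x ← find hit = n , ∈P.∈-upTo⁻ n∈ , natF-n≡x
  ... | no ¬hit = ⊥-elim (ℕP.<⇒≱ (ℕP.n<1+n p) (subst (_≤ p) #roots (subst (length roots ≤_) length-xᵖ-x bound)))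
    where
    x≢natF : All (λ n → ¬ x ≡ natF n) (upTo p)
    x≢natF = All.map (λ natF-n≢x x≡natF-n → natF-n≢x (sym x≡natF-n)) (AllP.¬Any⇒All¬ (upTo p) ¬hit)
    roots : List F
    roots = x ∷ map natF (upTo p)
    #roots : length roots ≡ suc p
    #roots = cong suc (trans (ListP.length-map natF (upTo p)) (ListP.length-upTo p))
    distinct-natF : ∀ l → All (_< p) l → AllPairs (λ a b → ¬ a ≡ b) l → AllPairs (λ a b → ¬ natF a ≡ natF b) l
    distinct-natF []      _             _             = []
    distinct-natF (m ∷ l) (m<p ∷ l<p) (m∉l ∷ u) =
      All.zipWith (λ (m≢n , n<p) eq → m≢n (natF-injective m<p n<p eq)) (m∉l , l<p) ∷ distinct-natF l l<p u
    unique : Unique roots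
    unique = AllP.map⁺ x≢natF ∷ AllPairsP.map⁺ (distinct-natF (upTo p) (All.tabulate ∈P.∈-upTo⁻) (UniqueP.upTo⁺ p))
    is-root : ∀ r → powF r p ≡ r → monic xᵖ-x r ≡ 𝟘
    is-root r rᵖ≡r = trans (monic-xᵖ-x r) (trans (cong (_⊕ ⊖ r) rᵖ≡r) (-‿inverseʳ r))
    all-roots : All (λ r → monic xᵖ-x r ≡ 𝟘) roots
    all-roots = is-root x xᵖ≡x ∷ AllP.map⁺ (All.tabulate (λ {n} _ → is-root (natF n) (powF-natF-p n)))
    bound : length roots ≤ length xᵖ-x
    bound = monic-roots-bound xᵖ-x roots unique all-roots

  partialTrace : ℕ → F → F
  partialTrace zero    x = 𝟘
  partialTrace (suc k) x = partialTrace k x ⊕ powF x (p ℕ.^ k)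

  tr≡partialTrace : ∀ a → tr a ≡ partialTrace e a
  tr≡partialTrace a = go e
    where
    go : ∀ k → ∑F.∑ (upTo k) (λ i → powF a (p ℕ.^ i)) ≡ partialTrace k a
    go zero    = refl
    go (suc k) = begin
      ∑F.∑ (upTo (suc k)) f              ≡⟨ cong (λ l → ∑F.∑ l f) (ListP.upTo-∷ʳ k) ⟨
      ∑F.∑ (upTo k ++ k ∷ []) f          ≡⟨ ∑F.∑-++ (upTo k) (k ∷ []) f ⟩
      ∑F.∑ (upTo k) f ⊕ (f k ⊕ 𝟘)        ≡⟨ cong₂ _⊕_ (go k) (+-identityʳ _) ⟩
      partialTrace k a ⊕ f k             ∎
      where
      f : ℕ → F
      f i = powF a (p ℕ.^ i)

  partialTrace-+ : ∀ k a b → partialTrace k (a ⊕ b) ≡ partialTrace k a ⊕ partialTrace k b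
  partialTrace-+ zero    a b = sym (+-identityʳ 𝟘)
  partialTrace-+ (suc k) a b = begin
    partialTrace k (a ⊕ b) ⊕ powF (a ⊕ b) (p ℕ.^ k)
      ≡⟨ cong₂ _⊕_ (partialTrace-+ k a b) (frobenius-^ k a b) ⟩
    (partialTrace k a ⊕ partialTrace k b) ⊕ (powF a (p ℕ.^ k) ⊕ powF b (p ℕ.^ k))
      ≡⟨ solve 4 (λ A B C D → (A :+ B) :+ (C :+ D) := (A :+ C) :+ (B :+ D)) refl _ _ _ _ ⟩
    (partialTrace k a ⊕ powF a (p ℕ.^ k)) ⊕ (partialTrace k b ⊕ powF b (p ℕ.^ k)) ∎

  tr-+ : ∀ a b → tr (a ⊕ b) ≡ tr a ⊕ tr b
  tr-+ a b = trans (tr≡partialTrace (a ⊕ b)) (trans (partialTrace-+ e a b) (sym (cong₂ _⊕_ (tr≡partialTrace a) (tr≡partialTrace b))))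

  tr-𝟘 : tr 𝟘 ≡ 𝟘
  tr-𝟘 = ⊕-cancelʳ (tr 𝟘) (trans (sym (tr-+ 𝟘 𝟘)) (trans (cong tr (+-identityˡ 𝟘)) (sym (+-identityˡ (tr 𝟘)))))

  partialTrace-frobenius : ∀ k x → powF (partialTrace k x) p ≡ partialTrace k (powF x p)
  partialTrace-frobenius zero    x = powF-𝟘-p
  partialTrace-frobenius (suc k) x = begin
    powF (partialTrace k x ⊕ powF x (p ℕ.^ k)) p
      ≡⟨ frobenius _ _ ⟩
    powF (partialTrace k x) p ⊕ powF (powF x (p ℕ.^ k)) p
      ≡⟨ cong₂ _⊕_ (partialTrace-frobenius k x) (powF-comm x (p ℕ.^ k) p) ⟩
    partialTrace k (powF x p) ⊕ powF (powF x p) (p ℕ.^ k)         ∎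

  partialTrace-shift : ∀ k x → x ⊕ partialTrace k (powF x p) ≡ partialTrace k x ⊕ powF x (p ℕ.^ k)
  partialTrace-shift zero    x = solve 1 (λ x → x :+ con (+ 0) := con (+ 0) :+ x :* con (+ 1)) refl x
  partialTrace-shift (suc k) x = begin
    x ⊕ (partialTrace k (powF x p) ⊕ powF (powF x p) (p ℕ.^ k))
      ≡⟨ +-assoc _ _ _ ⟨
    (x ⊕ partialTrace k (powF x p)) ⊕ powF (powF x p) (p ℕ.^ k)
      ≡⟨ cong₂ _⊕_ (partialTrace-shift k x) (sym (powF-* x p (p ℕ.^ k))) ⟩
    (partialTrace k x ⊕ powF x (p ℕ.^ k)) ⊕ powF x (p ℕ.^ suc k)      ∎

  tr-frobenius : ∀ x → powF (tr x) p ≡ tr x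
  tr-frobenius x = begin
    powF (tr x) p                    ≡⟨ cong (λ t → powF t p) (tr≡partialTrace x) ⟩
    powF (partialTrace e x) p        ≡⟨ partialTrace-frobenius e x ⟩
    partialTrace e (powF x p)        ≡⟨ ⊕-cancelʳ x (begin
        partialTrace e (powF x p) ⊕ x         ≡⟨ +-comm _ _ ⟩
        x ⊕ partialTrace e (powF x p)         ≡⟨ partialTrace-shift e x ⟩
        partialTrace e x ⊕ powF x (p ℕ.^ e)   ≡⟨ cong (partialTrace e x ⊕_) (powF-q x) ⟩
        partialTrace e x ⊕ x                  ∎) ⟩
    partialTrace e x                 ≡⟨ tr≡partialTrace x ⟨
    tr x                             ∎

  powF-fixed-^ : ∀ {l} k → powF l p ≡ l → powF l (p ℕ.^ k) ≡ l
  powF-fixed-^ {l} zero    lᵖ≡l = *-identityʳ l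
  powF-fixed-^ {l} (suc k) lᵖ≡l = trans (powF-* l p (p ℕ.^ k)) (trans (cong (λ t → powF t (p ℕ.^ k)) lᵖ≡l) (powF-fixed-^ k lᵖ≡l))

  partialTrace-scale : ∀ k {l} a → powF l p ≡ l → partialTrace k (l ⊗ a) ≡ l ⊗ partialTrace k a
  partialTrace-scale zero    {l} a lᵖ≡l = sym (zeroʳ l)
  partialTrace-scale (suc k) {l} a lᵖ≡l = begin
    partialTrace k (l ⊗ a) ⊕ powF (l ⊗ a) (p ℕ.^ k)
      ≡⟨ cong₂ _⊕_ (partialTrace-scale k a lᵖ≡l)
                   (trans (powF-distrib-⊗ l a (p ℕ.^ k)) (cong (_⊗ powF a (p ℕ.^ k)) (powF-fixed-^ k lᵖ≡l))) ⟩
    l ⊗ partialTrace k a ⊕ l ⊗ powF a (p ℕ.^ k)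
      ≡⟨ distribˡ l _ _ ⟨
    l ⊗ (partialTrace k a ⊕ powF a (p ℕ.^ k)) ∎

  tr-scale : ∀ {l} a → powF l p ≡ l → tr (l ⊗ a) ≡ l ⊗ tr a
  tr-scale {l} a lᵖ≡l = trans (tr≡partialTrace (l ⊗ a)) (trans (partialTrace-scale e a lᵖ≡l) (cong (l ⊗_) (sym (tr≡partialTrace a))))

  partialTraceCoefficients : ℕ → List F
  partialTraceCoefficients zero    = 𝟘 ∷ []
  partialTraceCoefficients (suc k) =
    (partialTraceCoefficients k ++ 𝟙 ∷ []) ++ replicate (p ℕ.^ suc k ℕ.∸ suc (p ℕ.^ k)) 𝟘

  pᵏ<pᵏ⁺¹ : ∀ k → p ℕ.^ k < p ℕ.^ suc k
  pᵏ<pᵏ⁺¹ k = subst (p ℕ.^ k <_) (ℕP.*-comm (p ℕ.^ k) p) (ℕP.m<m*n (p ℕ.^ k) p {{ℕP.m^n≢0 p k}} 1<p)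

  length-partialTraceCoefficients : ∀ k → length (partialTraceCoefficients k) ≡ p ℕ.^ k
  length-partialTraceCoefficients zero    = refl
  length-partialTraceCoefficients (suc k) = begin
    length ((partialTraceCoefficients k ++ 𝟙 ∷ []) ++ zeros)
      ≡⟨ ListP.length-++ (partialTraceCoefficients k ++ 𝟙 ∷ []) ⟩
    length (partialTraceCoefficients k ++ 𝟙 ∷ []) ℕ.+ length zeros
      ≡⟨ cong₂ ℕ._+_ (trans (ListP.length-++ (partialTraceCoefficients k))
                            (trans (cong (ℕ._+ 1) (length-partialTraceCoefficients k)) (ℕP.+-comm (p ℕ.^ k) 1)))
                     (ListP.length-replicate _) ⟩
    suc (p ℕ.^ k) ℕ.+ (p ℕ.^ suc k ℕ.∸ suc (p ℕ.^ k))
      ≡⟨ ℕP.m+[n∸m]≡n (pᵏ<pᵏ⁺¹ k) ⟩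
    p ℕ.^ suc k ∎
    where
    zeros : List F
    zeros = replicate (p ℕ.^ suc k ℕ.∸ suc (p ℕ.^ k)) 𝟘

  monic-partialTraceCoefficients : ∀ k x → monic (partialTraceCoefficients k) x ≡ partialTrace (suc k) x
  monic-partialTraceCoefficients zero    x =
    solve 1 (λ x → x :* con (+ 1) :+ (con (+ 0) :+ x :* con (+ 0)) := con (+ 0) :+ x :* con (+ 1)) refl x
  monic-partialTraceCoefficients (suc k) x = begin
    powF x (length (partialTraceCoefficients (suc k))) ⊕ eval ((cs ++ 𝟙 ∷ []) ++ zeros) x
      ≡⟨ cong₂ _⊕_ (cong (powF x) (length-partialTraceCoefficients (suc k))) (eval-++ (cs ++ 𝟙 ∷ []) zeros x) ⟩
    xᵖᵏ⁺¹ ⊕ (eval (cs ++ 𝟙 ∷ []) x ⊕ powF x (length (cs ++ 𝟙 ∷ [])) ⊗ eval zeros x)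
      ≡⟨ cong₂ (λ a b → xᵖᵏ⁺¹ ⊕ (a ⊕ powF x (length (cs ++ 𝟙 ∷ [])) ⊗ b))
               (eval-++ cs (𝟙 ∷ []) x) (eval-replicate-𝟘 (p ℕ.^ suc k ℕ.∸ suc (p ℕ.^ k)) x) ⟩
    xᵖᵏ⁺¹ ⊕ ((eval cs x ⊕ powF x (length cs) ⊗ (𝟙 ⊕ x ⊗ 𝟘)) ⊕ powF x (length (cs ++ 𝟙 ∷ [])) ⊗ 𝟘)
      ≡⟨ solve 5 (λ P E Q x W → P :+ ((E :+ Q :* (con (+ 1) :+ x :* con (+ 0))) :+ W :* con (+ 0)) := (Q :+ E) :+ P) refl _ _ _ x _ ⟩
    monic cs x ⊕ xᵖᵏ⁺¹
      ≡⟨ cong (_⊕ xᵖᵏ⁺¹) (monic-partialTraceCoefficients k x) ⟩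
    partialTrace (suc (suc k)) x ∎
    where
    cs zeros : List F
    cs = partialTraceCoefficients k
    zeros = replicate (p ℕ.^ suc k ℕ.∸ suc (p ℕ.^ k)) 𝟘
    xᵖᵏ⁺¹ : F
    xᵖᵏ⁺¹ = powF x (p ℕ.^ suc k)

  -- tr is the polynomial partialTrace e, of degree p^(e-1) < |F|, so it has a non-root.
  tr-nonvanishing : 1 ≤ e → Σ F λ a → ¬ tr a ≡ 𝟘
  tr-nonvanishing 1≤e with All.all? (λ x → tr x ≟ 𝟘) elems
  ... | no ¬all-𝟘 with a , _ , tr-a≢𝟘 ← find (AllP.¬All⇒Any¬ (λ x → tr x ≟ 𝟘) elems ¬all-𝟘) = a , tr-a≢𝟘
  ... | yes all-𝟘 = ⊥-elim (ℕP.<⇒≱ (pᵏ<pᵏ⁺¹ k) too-many-roots)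
    where
    k : ℕ
    k = ℕ.pred e
    e≡1+k : e ≡ suc k
    e≡1+k = sym (ℕP.suc-pred e {{ℕ.>-nonZero 1≤e}})
    roots : All (λ x → monic (partialTraceCoefficients k) x ≡ 𝟘) elems
    roots = All.map (λ {x} tr-x≡𝟘 → trans (monic-partialTraceCoefficients k x)
              (trans (cong (λ n → partialTrace n x) (sym e≡1+k)) (trans (sym (tr≡partialTrace x)) tr-x≡𝟘))) all-𝟘
    too-many-roots : p ℕ.^ suc k ≤ p ℕ.^ k
    too-many-roots = subst₂ _≤_ (trans card (cong (p ℕ.^_) e≡1+k)) (length-partialTraceCoefficients k)
      (monic-roots-bound (partialTraceCoefficients k) elems elems-unique roots)

  inv-frobenius-fixed : ∀ {t} → ¬ t ≡ 𝟘 → powF t p ≡ t → powF (inv t) p ≡ inv t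
  inv-frobenius-fixed {t} t≢𝟘 tᵖ≡t = ⊗-cancelʳ t≢𝟘 (begin
    powF (inv t) p ⊗ t              ≡⟨ cong (powF (inv t) p ⊗_) tᵖ≡t ⟨
    powF (inv t) p ⊗ powF t p       ≡⟨ powF-distrib-⊗ (inv t) t p ⟨
    powF (inv t ⊗ t) p              ≡⟨ cong (λ u → powF u p) (inv-inverseˡ t≢𝟘) ⟩
    powF 𝟙 p                        ≡⟨ powF-𝟙 p ⟩
    𝟙                               ≡⟨ inv-inverseˡ t≢𝟘 ⟨
    inv t ⊗ t                       ∎)

  tr-one : 1 ≤ e → Σ F λ c → tr c ≡ 𝟙
  tr-one 1≤e with tr-nonvanishing 1≤e
  ... | a , tr-a≢𝟘 = inv (tr a) ⊗ a ,
    trans (tr-scale a (inv-frobenius-fixed tr-a≢𝟘 (tr-frobenius a))) (inv-inverseˡ tr-a≢𝟘)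

  -- The search function local to trℕ, recovered by unification so that it can be reasoned about.
  private
    mutual
      trℕ-search : F → List ℕ → ℕ
      trℕ-search = _
      trℕ≡search : ∀ a → trℕ a ≡ trℕ-search a (upTo p)
      trℕ≡search a with upTo p
      ... | _ = refl

  natF-trℕ : ∀ a → natF (trℕ a) ≡ tr a
  natF-trℕ a with frobenius-fixed⇒natF (tr a) (tr-frobenius a)
  ... | n , n<p , natF-n≡tr = subst (λ t → natF t ≡ tr a) (sym (trℕ≡search a))
        (found (upTo p) (Any.map (λ n≡m → trans (cong natF (sym n≡m)) natF-n≡tr) (∈P.∈-upTo⁺ n<p)))
    where
    found : ∀ l → Any.Any (λ m → natF m ≡ tr a) l → natF (trℕ-search a l) ≡ tr a
    found (m ∷ l) hit with natF m ≟ tr a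
    ... | yes natF-m≡tr = natF-m≡tr
    ... | no  natF-m≢tr with hit
    ...   | here natF-m≡tr = ⊥-elim (natF-m≢tr natF-m≡tr)
    ...   | there hit′     = found l hit′

  trℕ<p : ∀ a → trℕ a < p
  trℕ<p a = subst (_< p) (sym (trℕ≡search a)) (bounded (upTo p) (λ m∈ → ∈P.∈-upTo⁻ m∈))
    where
    bounded : ∀ l → (∀ {m} → m ∈ l → m < p) → trℕ-search a l < p
    bounded []      _    = ℕP.<-trans (s≤s z≤n) 1<p
    bounded (m ∷ l) l<p with natF m ≟ tr a
    ... | yes _ = l<p (here refl)
    ... | no  _ = bounded l (λ m∈l → l<p (there m∈l))

  natF-trℕ-translate : ∀ {c} → tr c ≡ 𝟙 → ∀ y n → natF (trℕ (y ⊕ natF n ⊗ c)) ≡ natF (trℕ y ℕ.+ n)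
  natF-trℕ-translate {c} tr-c≡𝟙 y n = begin
    natF (trℕ (y ⊕ natF n ⊗ c))        ≡⟨ natF-trℕ _ ⟩
    tr (y ⊕ natF n ⊗ c)                ≡⟨ tr-+ y _ ⟩
    tr y ⊕ tr (natF n ⊗ c)             ≡⟨ cong (tr y ⊕_) (tr-scale c (powF-natF-p n)) ⟩
    tr y ⊕ natF n ⊗ tr c               ≡⟨ cong (λ t → tr y ⊕ natF n ⊗ t) tr-c≡𝟙 ⟩
    tr y ⊕ natF n ⊗ 𝟙                  ≡⟨ cong₂ _⊕_ (sym (natF-trℕ y)) (*-identityʳ _) ⟩
    natF (trℕ y) ⊕ natF n              ≡⟨ natF-+ (trℕ y) n ⟨
    natF (trℕ y ℕ.+ n)                 ∎

  trℕ-translate : ∀ {c} → tr c ≡ 𝟙 → ∀ {n} → n < p → ∀ y → 0 ≡ trℕ y ⇔ n ≡ trℕ (y ⊕ natF n ⊗ c)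
  trℕ-translate {c} tr-c≡𝟙 {n} n<p y = mk⇔
    (λ 0≡trℕ → natF-injective n<p (trℕ<p _) (sym (trans (natF-trℕ-translate tr-c≡𝟙 y n) (cong (λ t → natF (t ℕ.+ n)) (sym 0≡trℕ)))))
    (λ n≡trℕ → sym (natF≡𝟘⇒≡0 (trℕ<p y) (⊕-cancelʳ (natF n) (begin
      natF (trℕ y) ⊕ natF n               ≡⟨ natF-+ (trℕ y) n ⟨
      natF (trℕ y ℕ.+ n)                  ≡⟨ natF-trℕ-translate tr-c≡𝟙 y n ⟨
      natF (trℕ (y ⊕ natF n ⊗ c))         ≡⟨ cong natF n≡trℕ ⟨
      natF n                              ≡⟨ +-identityˡ (natF n) ⟨
      𝟘 ⊕ natF n                          ∎))))

  two≢𝟘 : ¬ p ≡ 2 → ¬ two ≡ 𝟘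
  two≢𝟘 p≢2 = natF-≢𝟘 (s≤s z≤n) (ℕP.≤∧≢⇒< 1<p (λ 2≡p → p≢2 (sym 2≡p)))

  four≢𝟘 : ¬ p ≡ 2 → ¬ four ≡ 𝟘
  four≢𝟘 p≢2 four≡𝟘 = ⊗-≢𝟘 (two≢𝟘 p≢2) (two≢𝟘 p≢2) (trans (sym (natF-* 2 2)) four≡𝟘)

module CharacterSums (FF : FiniteField) (p e : ℕ) (p-prime : Prime p)
                     (card : length (FiniteField.elems FF) ≡ p ℕ.^ e) (1≤e : 1 ≤ e)
                     {c ℓ : Level} (R : CommutativeRing c ℓ) (ζ : CommutativeRing.Carrier R)
                     (ζᵖ≡1 : CommutativeRing._≈_ R (ComplexNotions.powR FF p e R ζ ζ p) (CommutativeRing.1# R))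
                     (∑ζⁱ≡0 : CommutativeRing._≈_ R (ComplexNotions.sumR FF p e R ζ (map (ComplexNotions.powR FF p e R ζ ζ) (upTo p)))
                                                    (CommutativeRing.0# R)) where
  open PrimeCharacteristic FF p e p-prime card public
  open ComplexNotions FF p e R ζ public using (powR; natR; ζtr; ζ-tr; η; Sy2)
  open CommutativeRing R public using (Carrier; _≈_; _+_; _*_; -_; 0#; 1#)
  module R = CommutativeRing R
  open import Relation.Binary.Reasoning.Setoid R.setoid
  module ∑R = Sums R.+-commutativeMonoid
  open ∑R public using (∑; when)

  powR-+ : ∀ x m n → powR x (m ℕ.+ n) ≈ powR x m * powR x n
  powR-+ x zero    n = R.sym (R.*-identityˡ _)
  powR-+ x (suc m) n = R.trans (R.*-congˡ (powR-+ x m n)) (R.sym (R.*-assoc _ _ _))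

  ζ-multiple : ∀ k → powR ζ (k ℕ.* p) ≈ 1#
  ζ-multiple zero    = R.refl
  ζ-multiple (suc k) = R.trans (powR-+ ζ p (k ℕ.* p)) (R.trans (R.*-cong ζᵖ≡1 (ζ-multiple k)) (R.*-identityˡ 1#))

  ζ-% : ∀ n → powR ζ n ≈ powR ζ (n % p)
  ζ-% n = begin
    powR ζ n                                   ≡⟨ cong (powR ζ) (m≡m%n+[m/n]*n n p) ⟩
    powR ζ (n % p ℕ.+ (n / p) ℕ.* p)           ≈⟨ powR-+ ζ (n % p) _ ⟩
    powR ζ (n % p) * powR ζ ((n / p) ℕ.* p)    ≈⟨ R.*-congˡ (ζ-multiple (n / p)) ⟩
    powR ζ (n % p) * 1#                        ≈⟨ R.*-identityʳ _ ⟩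
    powR ζ (n % p)                             ∎

  ζ-natF : ∀ {m n} → natF m ≡ natF n → powR ζ m ≈ powR ζ n
  ζ-natF {m} {n} eq = R.trans (ζ-% m) (R.trans (R.reflexive (cong (powR ζ) (natF≡⇒%≡ eq))) (R.sym (ζ-% n)))

  ζtr-+ : ∀ a b → ζtr (a ⊕ b) ≈ ζtr a * ζtr b
  ζtr-+ a b = R.trans (ζ-natF {trℕ (a ⊕ b)} {trℕ a ℕ.+ trℕ b} natF-sum) (powR-+ ζ (trℕ a) (trℕ b))
    where
    natF-sum : natF (trℕ (a ⊕ b)) ≡ natF (trℕ a ℕ.+ trℕ b)
    natF-sum = trans (natF-trℕ (a ⊕ b)) (trans (tr-+ a b)
                 (sym (trans (natF-+ (trℕ a) (trℕ b)) (cong₂ _⊕_ (natF-trℕ a) (natF-trℕ b)))))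

  ζtr-𝟘 : ζtr 𝟘 ≈ 1#
  ζtr-𝟘 = ζ-natF {trℕ 𝟘} {0} (trans (natF-trℕ 𝟘) tr-𝟘)

  ζtr-*-ζ-tr : ∀ a → ζtr a * ζ-tr a ≈ 1#
  ζtr-*-ζ-tr a = R.trans (R.sym (powR-+ ζ (trℕ a) (p ℕ.∸ trℕ a)))
    (R.trans (R.reflexive (cong (powR ζ) (ℕP.m+[n∸m]≡n (ℕP.<⇒≤ (trℕ<p a))))) ζᵖ≡1)

  ζtr-⊖ : ∀ x y → ζtr (x ⊕ ⊖ y) ≈ ζtr x * ζ-tr y
  ζtr-⊖ x y = begin
    ζtr (x ⊕ ⊖ y)                            ≈⟨ R.*-identityʳ _ ⟨
    ζtr (x ⊕ ⊖ y) * 1#                       ≈⟨ R.*-congˡ (ζtr-*-ζ-tr y) ⟨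
    ζtr (x ⊕ ⊖ y) * (ζtr y * ζ-tr y)         ≈⟨ R.*-assoc _ _ _ ⟨
    (ζtr (x ⊕ ⊖ y) * ζtr y) * ζ-tr y         ≈⟨ R.*-congʳ (ζtr-+ (x ⊕ ⊖ y) y) ⟨
    ζtr ((x ⊕ ⊖ y) ⊕ y) * ζ-tr y             ≡⟨ cong (λ t → ζtr t * ζ-tr y) (x⊖y⊕y≡x x y) ⟩
    ζtr x * ζ-tr y                           ∎

  ∑-*ʳ : ∀ {A : Set} (l : List A) (f : A → Carrier) c → ∑ l (λ x → f x * c) ≈ ∑ l f * c
  ∑-*ʳ []      f c = R.sym (R.zeroˡ c)
  ∑-*ʳ (x ∷ l) f c = R.trans (R.+-congˡ (∑-*ʳ l f c)) (R.sym (R.distribʳ c (f x) _))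

  when-cong : ∀ b {u v} → u ≈ v → when b u ≈ when b v
  when-cong true  u≈v = u≈v
  when-cong false u≈v = R.refl

  when-ε : ∀ b → when b 0# ≈ 0#
  when-ε true  = R.refl
  when-ε false = R.refl

  ∑-1 : ∀ {A : Set} (l : List A) → ∑ l (λ _ → 1#) ≈ natR (length l)
  ∑-1 []      = R.refl
  ∑-1 (x ∷ l) = R.+-congˡ (∑-1 l)

  -- Translation by n·c with tr c = 1 maps the trace fiber over 0 onto the one over n.
  trace-fibers-equal : ∀ {n} → n < p → ∀ v →
    ∑ elems (λ y → when (does (n ℕ.≟ trℕ y)) v) ≈ ∑ elems (λ y → when (does (0 ℕ.≟ trℕ y)) v)
  trace-fibers-equal {n} n<p v = R.sym (R.trans (∑R.∑-cong elems same-fiber)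
                                               (∑R.∑-translate (natF n ⊗ c₁) (λ y → when (does (n ℕ.≟ trℕ y)) v)))
    where
    c₁ : F
    c₁ = proj₁ (tr-one 1≤e)
    same-fiber : ∀ y → when (does (0 ℕ.≟ trℕ y)) v ≈ when (does (n ℕ.≟ trℕ (y ⊕ natF n ⊗ c₁))) v
    same-fiber y = ∑R.when-≟-cong ℕ._≟_ v (trℕ-translate (proj₂ (tr-one 1≤e)) n<p y)

  ∑ζtr≡0 : ∑ elems ζtr ≈ 0#
  ∑ζtr≡0 = begin
    ∑ elems ζtr
      ≈⟨ ∑R.∑-cong elems (λ y → R.sym (∑R.∑-select ℕ._≟_ (upTo p) (trℕ y) (powR ζ) (UniqueP.upTo⁺ p) (∈P.∈-upTo⁺ (trℕ<p y)))) ⟩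
    ∑ elems (λ y → ∑ (upTo p) (λ n → when (does (n ℕ.≟ trℕ y)) (powR ζ n)))
      ≈⟨ ∑R.∑-swap elems (upTo p) _ ⟩
    ∑ (upTo p) (λ n → ∑ elems (λ y → when (does (n ℕ.≟ trℕ y)) (powR ζ n)))
      ≈⟨ ∑R.∑-cong-∈ (upTo p) (λ n n∈ → trace-fibers-equal (∈P.∈-upTo⁻ n∈) (powR ζ n)) ⟩
    ∑ (upTo p) (λ n → ∑ elems (λ y → when (does (0 ℕ.≟ trℕ y)) (powR ζ n)))
      ≈⟨ ∑R.∑-swap (upTo p) elems _ ⟩
    ∑ elems (λ y → ∑ (upTo p) (λ n → when (does (0 ℕ.≟ trℕ y)) (powR ζ n)))
      ≈⟨ ∑R.∑-cong elems (λ y → ∑R.∑-when (upTo p) (does (0 ℕ.≟ trℕ y)) (powR ζ)) ⟩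
    ∑ elems (λ y → when (does (0 ℕ.≟ trℕ y)) (∑ (upTo p) (powR ζ)))
      ≈⟨ ∑R.∑-cong elems (λ y → when-cong (does (0 ℕ.≟ trℕ y)) ∑ζⁱ≡0) ⟩
    ∑ elems (λ y → when (does (0 ℕ.≟ trℕ y)) 0#)
      ≈⟨ ∑R.∑-cong elems (λ y → when-ε (does (0 ℕ.≟ trℕ y))) ⟩
    ∑ elems (λ _ → 0#)
      ≈⟨ ∑R.∑-ε elems ⟩
    0# ∎

  ∑ζtr-scale≡0 : ∀ {a} → ¬ a ≡ 𝟘 → ∑ elems (λ x → ζtr (a ⊗ x)) ≈ 0#
  ∑ζtr-scale≡0 a≢𝟘 = R.trans (∑R.∑-scale a≢𝟘 ζtr) ∑ζtr≡0

  module QuadraticSums (p≢2 : ¬ p ≡ 2) where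
    open OddCharacteristic (two≢𝟘 p≢2)
    open Fibers R.+-commutativeMonoid

    ∑ζtr-quadratic-by-value : ∀ H → ∑ elems (λ b → ζtr (H ⊗ (b ⊗ b))) ≈ ∑ elems (λ y → fiber H y (ζtr y))
    ∑ζtr-quadratic-by-value H = R.trans
      (∑R.∑-cong elems (λ b → R.sym (∑R.∑-select-elems (H ⊗ (b ⊗ b)) ζtr)))
      (∑R.∑-swap elems elems (λ b y → when (does (y ≟ (H ⊗ (b ⊗ b)))) (ζtr y)))

    Sy2≈∑ζtr-𝟙 : Sy2 ≈ ∑ elems (λ b → ζtr (𝟙 ⊗ (b ⊗ b)))
    Sy2≈∑ζtr-𝟙 = ∑R.∑-cong elems (λ b → R.reflexive (cong ζtr (sym (*-identityˡ (b ⊗ b)))))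

    gauss-sum-square : ∀ {G} → ¬ G ≡ 𝟘 → Square G → ∑ elems (λ b → ζtr (G ⊗ (b ⊗ b))) ≈ Sy2
    gauss-sum-square {G} G≢𝟘 (g , g²≡G) = R.trans (∑R.∑-cong elems regroup) (∑R.∑-scale g≢𝟘 (λ a → ζtr (a ⊗ a)))
      where
      g≢𝟘 : ¬ g ≡ 𝟘
      g≢𝟘 refl = G≢𝟘 (trans (sym g²≡G) (zeroʳ 𝟘))
      regroup : ∀ b → ζtr (G ⊗ (b ⊗ b)) ≈ ζtr ((g ⊗ b) ⊗ (g ⊗ b))
      regroup b = R.reflexive (cong ζtr (trans (cong (_⊗ (b ⊗ b)) (sym g²≡G))
        (solve 2 (λ g b → (g :* g) :* (b :* b) := (g :* b) :* (g :* b)) refl g b)))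

    gauss-sum-nonsquare : ∀ {G} → ¬ G ≡ 𝟘 → ¬ Square G → ∑ elems (λ b → ζtr (G ⊗ (b ⊗ b))) + Sy2 ≈ 0#
    gauss-sum-nonsquare {G} G≢𝟘 ¬sqG = begin
      ∑ elems (λ b → ζtr (G ⊗ (b ⊗ b))) + Sy2
        ≈⟨ R.+-cong (∑ζtr-quadratic-by-value G) (R.trans Sy2≈∑ζtr-𝟙 (∑ζtr-quadratic-by-value 𝟙)) ⟩
      ∑ elems (λ y → fiber G y (ζtr y)) + ∑ elems (λ y → fiber 𝟙 y (ζtr y))
        ≈⟨ ∑R.∑-∙ elems _ _ ⟨
      ∑ elems (λ y → fiber G y (ζtr y) + fiber 𝟙 y (ζtr y))
        ≈⟨ ∑R.∑-cong elems (λ y → fiber-nonsquare-∙-fiber-𝟙 R.+-commutativeMonoid G≢𝟘 ¬sqG y (ζtr y)) ⟩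
      ∑ elems (λ y → ζtr y + ζtr y)
        ≈⟨ ∑R.∑-∙ elems ζtr ζtr ⟩
      ∑ elems ζtr + ∑ elems ζtr
        ≈⟨ R.+-cong ∑ζtr≡0 ∑ζtr≡0 ⟩
      0# + 0#
        ≈⟨ R.+-identityˡ 0# ⟩
      0# ∎

    gauss-sum : ∀ {G} → ¬ G ≡ 𝟘 → ∑ elems (λ b → ζtr (G ⊗ (b ⊗ b))) ≈ η G * Sy2
    gauss-sum {G} G≢𝟘 with G ≟ 𝟘
    ... | yes G≡𝟘 = ⊥-elim (G≢𝟘 G≡𝟘)
    ... | no  _   with isSquare G in isSquare≡
    ...   | true  = R.trans (gauss-sum-square G≢𝟘 (isSquare⇒Square G isSquare≡)) (R.sym (R.*-identityˡ Sy2))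
    ...   | false = begin
      S                          ≈⟨ R.+-identityʳ S ⟨
      S + 0#                     ≈⟨ R.+-congˡ (R.-‿inverseʳ Sy2) ⟨
      S + (Sy2 + - Sy2)          ≈⟨ R.+-assoc _ _ _ ⟨
      (S + Sy2) + - Sy2          ≈⟨ R.+-congʳ (gauss-sum-nonsquare G≢𝟘 (isSquare≡false⇒¬Square G isSquare≡)) ⟩
      0# + - Sy2                 ≈⟨ R.+-identityˡ _ ⟩
      - Sy2                      ≈⟨ -1*x≈-x Sy2 ⟨
      - 1# * Sy2                 ∎
      where
      open import Algebra.Properties.Ring R.ring using (-1*x≈-x)
      S : Carrier
      S = ∑ elems (λ b → ζtr (G ⊗ (b ⊗ b)))

    -- G a² + c a = G (a + h)² - w with h = c / 2G and w = G h² = c² / 4G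
    module CompletingTheSquare {G} (c : F) (G≢𝟘 : ¬ G ≡ 𝟘) where
      h w : F
      h = c ÷ (two ⊗ G)
      w = G ⊗ (h ⊗ h)

      c≡h·2G : c ≡ h ⊗ (two ⊗ G)
      c≡h·2G = sym (⊗-inv-cancelʳ c (⊗-≢𝟘 (two≢𝟘 p≢2) G≢𝟘))

      w≡c²÷4G : w ≡ (c ⊗ c) ÷ (four ⊗ G)
      w≡c²÷4G = ⊗≡⇒≡÷ (⊗-≢𝟘 (four≢𝟘 p≢2) G≢𝟘) (trans
        (solve 2 (λ G h → G :* (h :* h) :* (:four :* G) := (h :* (:two :* G)) :* (h :* (:two :* G))) refl G h)
        (cong (λ t → t ⊗ t) (sym c≡h·2G)))

      shifted : ∀ b → G ⊗ ((b ⊕ ⊖ h) ⊗ (b ⊕ ⊖ h)) ⊕ c ⊗ (b ⊕ ⊖ h) ≡ G ⊗ (b ⊗ b) ⊕ ⊖ w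
      shifted b = trans (cong (λ t → G ⊗ ((b ⊕ ⊖ h) ⊗ (b ⊕ ⊖ h)) ⊕ t ⊗ (b ⊕ ⊖ h)) c≡h·2G)
        (solve 3 (λ G h b → G :* ((b :- h) :* (b :- h)) :+ (h :* (:two :* G)) :* (b :- h)
                         := G :* (b :* b) :- G :* (h :* h)) refl G h b)

    ∑ζtr-quadratic : ∀ {G} c → ¬ G ≡ 𝟘 →
      ∑ elems (λ a → ζtr (G ⊗ (a ⊗ a) ⊕ c ⊗ a)) ≈ η G * ζ-tr ((c ⊗ c) ÷ (four ⊗ G)) * Sy2
    ∑ζtr-quadratic {G} c G≢𝟘 = begin
      ∑ elems (λ a → ζtr (G ⊗ (a ⊗ a) ⊕ c ⊗ a))
        ≈⟨ ∑R.∑-translate (⊖ h) (λ a → ζtr (G ⊗ (a ⊗ a) ⊕ c ⊗ a)) ⟨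
      ∑ elems (λ b → ζtr (G ⊗ ((b ⊕ ⊖ h) ⊗ (b ⊕ ⊖ h)) ⊕ c ⊗ (b ⊕ ⊖ h)))
        ≈⟨ ∑R.∑-cong elems (λ b → R.reflexive (cong ζtr (shifted b))) ⟩
      ∑ elems (λ b → ζtr (G ⊗ (b ⊗ b) ⊕ ⊖ w))
        ≈⟨ ∑R.∑-cong elems (λ b → ζtr-⊖ (G ⊗ (b ⊗ b)) w) ⟩
      ∑ elems (λ b → ζtr (G ⊗ (b ⊗ b)) * ζ-tr w)
        ≈⟨ ∑-*ʳ elems (λ b → ζtr (G ⊗ (b ⊗ b))) (ζ-tr w) ⟩
      ∑ elems (λ b → ζtr (G ⊗ (b ⊗ b))) * ζ-tr w
        ≈⟨ R.*-congʳ (gauss-sum G≢𝟘) ⟩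
      (η G * Sy2) * ζ-tr w
        ≈⟨ R.*-assoc _ _ _ ⟩
      η G * (Sy2 * ζ-tr w)
        ≈⟨ R.*-congˡ (R.*-comm _ _) ⟩
      η G * (ζ-tr w * Sy2)
        ≈⟨ R.*-assoc _ _ _ ⟨
      η G * ζ-tr w * Sy2
        ≡⟨ cong (λ t → η G * ζ-tr t * Sy2) w≡c²÷4G ⟩
      η G * ζ-tr ((c ⊗ c) ÷ (four ⊗ G)) * Sy2 ∎
      where open CompletingTheSquare c G≢𝟘

module MatrixEntry (FF : FiniteField) (p e : ℕ) (p-prime : Prime p) (p≢2 : ¬ p ≡ 2)
                   (card : length (FiniteField.elems FF) ≡ p ℕ.^ e) (1≤e : 1 ≤ e)
                   {c ℓ : Level} (R : CommutativeRing c ℓ) (ζ : CommutativeRing.Carrier R)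
                   (ζᵖ≡1 : CommutativeRing._≈_ R (ComplexNotions.powR FF p e R ζ ζ p) (CommutativeRing.1# R))
                   (∑ζⁱ≡0 : CommutativeRing._≈_ R (ComplexNotions.sumR FF p e R ζ (map (ComplexNotions.powR FF p e R ζ ζ) (upTo p)))
                                                  (CommutativeRing.0# R))
                   {τ : FiniteField.F FF} (τ≢𝟘 : ¬ τ ≡ FiniteField.𝟘 FF) (μ j k : FiniteField.F FF) where
  open CharacterSums FF p e p-prime card 1≤e R ζ ζᵖ≡1 ∑ζⁱ≡0
  open QuadraticSums p≢2
  open ComplexNotions FF p e R ζ using (Nentry; NS)
  open import Relation.Binary.Reasoning.Setoid R.setoid

  G F′ : F
  G  = Gτ τ j k
  F′ = Fτμ τ μ j k

  x₀ : F
  x₀ = (k ⊕ ⊖ j) ÷ (two ⊗ τ)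

  2τ≢𝟘 : ¬ two ⊗ τ ≡ 𝟘
  2τ≢𝟘 = ⊗-≢𝟘 (two≢𝟘 p≢2) τ≢𝟘

  x₀·2τ≡k⊖j : x₀ ⊗ (two ⊗ τ) ≡ k ⊕ ⊖ j
  x₀·2τ≡k⊖j = ⊗-inv-cancelʳ (k ⊕ ⊖ j) 2τ≢𝟘

  column⇒≡x₀ : ∀ {x} → k ≡ two ⊗ τ ⊗ x ⊕ j → x ≡ x₀
  column⇒≡x₀ {x} k≡2τx+j = ⊗≡⇒≡÷ 2τ≢𝟘 (trans
    (solve 3 (λ x t j → x :* t := (t :* x :+ j) :- j) refl x (two ⊗ τ) j)
    (cong (_⊕ ⊖ j) (sym k≡2τx+j)))

  column-x₀ : k ≡ two ⊗ τ ⊗ x₀ ⊕ j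
  column-x₀ = sym (trans (cong (_⊕ j) (trans (*-comm (two ⊗ τ) x₀) x₀·2τ≡k⊖j)) (x⊖y⊕y≡x k j))

  x₀≡𝟘⇒j≡k : x₀ ≡ 𝟘 → j ≡ k
  x₀≡𝟘⇒j≡k x₀≡𝟘 = sym (trans (sym (x⊖y⊕y≡x k j))
    (trans (cong (_⊕ j) (trans (sym x₀·2τ≡k⊖j) (trans (cong (_⊗ (two ⊗ τ)) x₀≡𝟘) (zeroˡ _)))) (+-identityˡ j)))

  j≡k⇒x₀≡𝟘 : j ≡ k → x₀ ≡ 𝟘
  j≡k⇒x₀≡𝟘 refl = trans (cong (_⊗ inv (two ⊗ τ)) (-‿inverseʳ j)) (zeroˡ _)

  G≡x₀j+τx₀² : x₀ ⊗ j ⊕ τ ⊗ (x₀ ⊗ x₀) ≡ G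
  G≡x₀j+τx₀² = ⊗≡⇒≡÷ (⊗-≢𝟘 (four≢𝟘 p≢2) τ≢𝟘) (trans
    (solve 3 (λ x j τ → (x :* j :+ τ :* (x :* x)) :* (:four :* τ)
                      := :two :* (x :* (:two :* τ)) :* j :+ (x :* (:two :* τ)) :* (x :* (:two :* τ))) refl x₀ j τ)
    (trans (cong (λ d → two ⊗ d ⊗ j ⊕ d ⊗ d) x₀·2τ≡k⊖j)
    (solve 2 (λ k j → :two :* (k :- j) :* j :+ (k :- j) :* (k :- j) := k :* k :- j :* j) refl k j)))

  F′≡μx₀ : μ ⊗ x₀ ≡ F′
  F′≡μx₀ = sym (*-assoc μ (k ⊕ ⊖ j) (inv (two ⊗ τ)))

  j≡k⇒G≡𝟘 : j ≡ k → G ≡ 𝟘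
  j≡k⇒G≡𝟘 j≡k = trans (sym G≡x₀j+τx₀²) (trans (cong (λ x → x ⊗ j ⊕ τ ⊗ (x ⊗ x)) (j≡k⇒x₀≡𝟘 j≡k))
    (solve 2 (λ j τ → con (+ 0) :* j :+ τ :* (con (+ 0) :* con (+ 0)) := con (+ 0)) refl j τ))

  -- x₃ j + τ x₅ + μ x₂ for the element Sgen x a
  exponent : F → F → F
  exponent x a = (x ⊗ a ⊗ a) ⊗ j ⊕ τ ⊗ (x ⊗ x ⊗ a ⊗ a) ⊕ μ ⊗ (x ⊗ a)

  exponent-x₀ : ∀ a → exponent x₀ a ≡ G ⊗ (a ⊗ a) ⊕ F′ ⊗ a
  exponent-x₀ a = trans
    (solve 5 (λ x a j τ μ → (x :* a :* a) :* j :+ τ :* (x :* x :* a :* a) :+ μ :* (x :* a)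
                          := (x :* j :+ τ :* (x :* x)) :* (a :* a) :+ (μ :* x) :* a) refl x₀ a j τ μ)
    (cong₂ (λ g f → g ⊗ (a ⊗ a) ⊕ f ⊗ a) G≡x₀j+τx₀² F′≡μx₀)

  Q : Carrier
  Q = ∑ elems (λ a → ζtr (G ⊗ (a ⊗ a) ⊕ F′ ⊗ a))

  nonzero? : (x : F) → Dec (¬ x ≡ 𝟘)
  nonzero? x = ¬? (x ≟ 𝟘)

  entry-Sgen : ∀ x a → Nentry τ μ (Sgen x a) j k ≈ when (does (k ≟ (two ⊗ τ ⊗ x ⊕ j))) (ζtr (exponent x a))
  entry-Sgen x a with k ≟ (two ⊗ τ ⊗ x ⊕ j)
  ... | yes _ = R.refl
  ... | no  _ = R.refl

  only-x₀ : ∀ x → when (does (nonzero? x)) (when (does (k ≟ (two ⊗ τ ⊗ x ⊕ j))) (∑ elems (λ a → ζtr (exponent x a))))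
                ≈ when (does (x ≟ x₀)) (when (does (nonzero? x₀)) Q)
  only-x₀ x with x ≟ x₀
  ... | yes refl with k ≟ (two ⊗ τ ⊗ x₀ ⊕ j)
  ...   | yes _      = when-cong (does (nonzero? x₀)) (∑R.∑-cong elems (λ a → R.reflexive (cong ζtr (exponent-x₀ a))))
  ...   | no  k≢     = ⊥-elim (k≢ column-x₀)
  only-x₀ x | no x≢x₀ with k ≟ (two ⊗ τ ⊗ x ⊕ j)
  ...   | yes k≡     = ⊥-elim (x≢x₀ (column⇒≡x₀ k≡))
  ...   | no  _      = when-ε (does (nonzero? x))

  NS≈Q-if-x₀≢𝟘 : NS τ μ j k ≈ when (does (nonzero? x₀)) Q
  NS≈Q-if-x₀≢𝟘 = begin
    NS τ μ j k
      ≈⟨ ∑R.∑-concatMap (λ x → map (Sgen x) elems) (filter nonzero? elems) (λ g → Nentry τ μ g j k) ⟩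
    ∑ (filter nonzero? elems) (λ x → ∑ (map (Sgen x) elems) (λ g → Nentry τ μ g j k))
      ≈⟨ ∑R.∑-cong (filter nonzero? elems) (λ x → ∑R.∑-map (Sgen x) elems (λ g → Nentry τ μ g j k)) ⟩
    ∑ (filter nonzero? elems) (λ x → ∑ elems (λ a → Nentry τ μ (Sgen x a) j k))
      ≈⟨ ∑R.∑-filter nonzero? elems _ ⟩
    ∑ elems (λ x → when (does (nonzero? x)) (∑ elems (λ a → Nentry τ μ (Sgen x a) j k)))
      ≈⟨ ∑R.∑-cong elems (λ x → when-cong (does (nonzero? x))
           (R.trans (∑R.∑-cong elems (entry-Sgen x)) (∑R.∑-when elems _ (λ a → ζtr (exponent x a))))) ⟩
    ∑ elems (λ x → when (does (nonzero? x)) (when (does (k ≟ (two ⊗ τ ⊗ x ⊕ j))) (∑ elems (λ a → ζtr (exponent x a)))))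
      ≈⟨ ∑R.∑-cong elems only-x₀ ⟩
    ∑ elems (λ x → when (does (x ≟ x₀)) (when (does (nonzero? x₀)) Q))
      ≈⟨ ∑R.∑-select-elems x₀ (λ _ → when (does (nonzero? x₀)) Q) ⟩
    when (does (nonzero? x₀)) Q ∎

  NS≈Q : ¬ j ≡ k → NS τ μ j k ≈ Q
  NS≈Q j≢k with x₀ ≟ 𝟘 | NS≈Q-if-x₀≢𝟘
  ... | yes x₀≡𝟘 | _      = ⊥-elim (j≢k (x₀≡𝟘⇒j≡k x₀≡𝟘))
  ... | no  _    | NS≈Q′  = NS≈Q′

  NS≈0-diagonal : j ≡ k → NS τ μ j k ≈ 0#
  NS≈0-diagonal j≡k with x₀ ≟ 𝟘 | NS≈Q-if-x₀≢𝟘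
  ... | yes _    | NS≈0   = NS≈0
  ... | no x₀≢𝟘  | _      = ⊥-elim (x₀≢𝟘 (j≡k⇒x₀≡𝟘 j≡k))

  Q≈∑ζtr-linear : G ≡ 𝟘 → Q ≈ ∑ elems (λ a → ζtr (F′ ⊗ a))
  Q≈∑ζtr-linear G≡𝟘 = ∑R.∑-cong elems (λ a → R.reflexive (cong ζtr
    (trans (cong (λ g → g ⊗ (a ⊗ a) ⊕ F′ ⊗ a) G≡𝟘) (trans (cong (_⊕ F′ ⊗ a) (zeroˡ _)) (+-identityˡ _)))))

  NS≈gauss : ¬ G ≡ 𝟘 → NS τ μ j k ≈ η G * ζ-tr ((F′ ⊗ F′) ÷ (four ⊗ G)) * Sy2
  NS≈gauss G≢𝟘 = R.trans (NS≈Q (λ j≡k → G≢𝟘 (j≡k⇒G≡𝟘 j≡k))) (∑ζtr-quadratic F′ G≢𝟘)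

  NS≈0-linear : G ≡ 𝟘 → ¬ F′ ≡ 𝟘 → NS τ μ j k ≈ 0#
  NS≈0-linear G≡𝟘 F′≢𝟘 with j ≟ k
  ... | yes j≡k = NS≈0-diagonal j≡k
  ... | no  j≢k = R.trans (NS≈Q j≢k) (R.trans (Q≈∑ζtr-linear G≡𝟘) (∑ζtr-scale≡0 F′≢𝟘))

  NS≈q : G ≡ 𝟘 → F′ ≡ 𝟘 → ¬ j ≡ k → NS τ μ j k ≈ natR (p ℕ.^ e)
  NS≈q G≡𝟘 F′≡𝟘 j≢k = begin
    NS τ μ j k
      ≈⟨ NS≈Q j≢k ⟩
    Q
      ≈⟨ Q≈∑ζtr-linear G≡𝟘 ⟩
    ∑ elems (λ a → ζtr (F′ ⊗ a))
      ≈⟨ ∑R.∑-cong elems (λ a → R.trans (R.reflexive (cong ζtr (trans (cong (_⊗ a) F′≡𝟘) (zeroˡ a)))) ζtr-𝟘) ⟩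
    ∑ elems (λ _ → 1#)
      ≈⟨ ∑-1 elems ⟩
    natR (length elems)
      ≡⟨ cong natR card ⟩
    natR (p ℕ.^ e)                   ∎

lemma6p1 : (FF : FiniteField) (p e : ℕ) → Prime p → ¬ (p ≡ 2) → 1 ≤ e →
    length (FiniteField.elems FF) ≡ p ℕ.^ e →
    ∀ {c ℓ} (R : CommutativeRing c ℓ) (ζ : CommutativeRing.Carrier R) →
    let open ComplexNotions FF p e R ζ in
    powR ζ p ≈ 1# → sumR (map (powR ζ) (upTo p)) ≈ 0# →
    (τ : F) → ¬ (τ ≡ 𝟘) → (μ j k : F) →
    (¬ (Gτ τ j k ≡ 𝟘) →
       NS τ μ j k ≈ η (Gτ τ j k) * ζ-tr ((Fτμ τ μ j k ⊗ Fτμ τ μ j k) ÷ (four ⊗ Gτ τ j k)) * Sy2)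
    × (Gτ τ j k ≡ 𝟘 → ¬ (Fτμ τ μ j k ≡ 𝟘) → NS τ μ j k ≈ 0#)
    × (j ≡ k → NS τ μ j k ≈ 0#)
    × (Gτ τ j k ≡ 𝟘 → Fτμ τ μ j k ≡ 𝟘 → ¬ (j ≡ k) → NS τ μ j k ≈ natR (p ℕ.^ e))
lemma6p1 FF p e p-prime p≢2 1≤e card R ζ ζᵖ≡1 ∑ζⁱ≡0 τ τ≢𝟘 μ j k =
  NS≈gauss , NS≈0-linear , NS≈0-diagonal , NS≈q
  where open MatrixEntry FF p e p-prime p≢2 card 1≤e R ζ ζᵖ≡1 ∑ζⁱ≡0 τ≢𝟘 μ j k
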